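{- Let $N$ be a positive integer and $r\geq 3$. For all $P\in\mathbf W_{N,r}$, $$\pi(-P)\,E^{(r-1)}_{N,r}=\pi(P)\,F_{N,r}.$$
   Context: All vector spaces over $\mathbb Q$. $S_{N,r}=\{(n_1,\dots,n_r)\in\mathbb Z^r: \sum n_i=N,\ n_i\geq 3\text{ odd}\}$, lexicographically decreasingly ordered. $\mathsf{Vect}_{N,r}=\mathbb Q^{S_{N,r}}$ (row vectors); $\mathbf V_{N,r}$ is the span of $x_1^{n_1-1}\cdots x_r^{n_r-1}$, $(n_i)\in S_{N,r}$; $\pi:\mathbf V_{N,r}\to\mathsf{Vect}_{N,r}$ maps a polynomial to its coefficient vector. $\mathbf W_{N,r}=\{P\in\mathbf V_{N,r}: P(x_1,\dots,x_r)=P(x_2-x_1,x_2,x_3,\dots,x_r)-P(x_2-x_1,x_1,x_3,\dots,x_r)\}$. For $f$ in one variable and $g$ in $r-1$ variables, $(f\circ g)(x_1,\dots,x_r)=f(x_1)g(x_2,\dots,x_r)+\sum_{i=1}^{r-1}\big(f(x_{i+1}-x_i)g(x_1,\dots,\widehat{x_{i+1}},\dots,x_r)-(-1)^{\deg f}f(x_i-x_{i+1})g(x_1,\dots,\widehat{x_i},\dots,x_r)\big)$ (hats denote omission); $e\binom{m_1,\dots,m_r}{n_1,\dots,n_r}$ is the coefficient of $x_1^{n_1-1}\cdots x_r^{n_r-1}$ in $x_1^{m_1-1}\circ(x_1^{m_2-1}\cdots x_{r-1}^{m_r-1})$. $E_{N,r}$ is the $S_{N,r}\times S_{N,r}$ matrix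 with $(m,n)$ entry $e\binom{m_1,\dots,m_r}{n_1,\dots,n_r}$; for $2\le j\le r$, $E^{(j)}_{N,r}$ has $(m,n)$ entry $\delta_{(m_1,\dots,m_{r-j}),(n_1,\dots,n_{r-j})}\,e\binom{m_{r-j+1},\dots,m_r}{n_{r-j+1},\dots,n_r}$ (Kronecker delta). $F_{N,r}=E_{N,r}-\mathrm{id}$. -}

module Defs where

open import Data.Nat as ℕ using (ℕ; zero; suc; _≤_; _%_; pred)
import Data.Nat.Properties as ℕP
open import Data.Rational as ℚ using (ℚ; 0ℚ; 1ℚ; _+_; _*_; -_; _-_)
open import Data.Fin using (Fin; zero; suc; inject₁; punchIn)
open import Data.Vec as V using (Vec; []; _∷_)
open import Data.Vec.Properties using (≡-dec)
open import Data.Vec.Relation.Unary.All as VAll using ()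
open import Data.List as L using (List; []; _∷_; _++_)
open import Data.Product using (_×_; _,_; Σ)
open import Relation.Binary.PropositionalEquality using (_≡_)
open import Relation.Nullary using (Dec; yes; no; ¬_)
open import Relation.Nullary.Decidable using (_×-dec_)

-- A polynomial in r variables x₁..x_r (indexed by Fin r) is a finite
-- formal sum of terms c · x^α, stored as a list of (c , α) with
-- α : Vec ℕ r the exponent vector.  Two polynomials are equal iff all
-- their coefficients agree (see coeff / _≈ₚ_).

Poly : ℕ → Set
Poly r = List (ℚ × Vec ℕ r)

coeff : ∀ {r} → Poly r → Vec ℕ r → ℚ
coeff [] β = 0ℚ
coeff ((c , α) ∷ p) β with ≡-dec ℕ._≟_ α β
... | yes _ = c + coeff p β
... | no  _ = coeff p β

_≈ₚ_ : ∀ {r} → Poly r → Poly r → Set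
p ≈ₚ q = ∀ β → coeff p β ≡ coeff q β

zeroₚ : ∀ {r} → Poly r
zeroₚ = []

constₚ : ∀ {r} → ℚ → Poly r
constₚ c = (c , V.replicate _ 0) ∷ []

mono : ∀ {r} → Vec ℕ r → Poly r
mono β = (1ℚ , β) ∷ []

unitVec : ∀ {r} → Fin r → Vec ℕ r
unitVec {suc r} zero    = 1 ∷ V.replicate r 0
unitVec {suc r} (suc i) = 0 ∷ unitVec i

-- the variable x_{i+1} (0-based index i)
var : ∀ {r} → Fin r → Poly r
var i = mono (unitVec i)

infixl 6 _+ₚ_ _-ₚ_
infixl 7 _*ₚ_

_+ₚ_ : ∀ {r} → Poly r → Poly r → Poly r
p +ₚ q = p ++ q

-ₚ_ : ∀ {r} → Poly r → Poly r
-ₚ p = L.map (λ { (c , α) → (- c , α) }) p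

_-ₚ_ : ∀ {r} → Poly r → Poly r → Poly r
p -ₚ q = p +ₚ (-ₚ q)

scaleₚ : ∀ {r} → ℚ → Poly r → Poly r
scaleₚ c p = L.map (λ { (d , α) → (c * d , α) }) p

_*ₚ_ : ∀ {r} → Poly r → Poly r → Poly r
p *ₚ q = L.concatMap (λ { (c , α) → L.map (λ { (d , β) → (c * d , V.zipWith ℕ._+_ α β) }) q }) p

_^ₚ_ : ∀ {r} → Poly r → ℕ → Poly r
p ^ₚ zero  = constₚ 1ℚ
p ^ₚ suc n = p *ₚ (p ^ₚ n)

sumₚ : ∀ {r} k → (Fin k → Poly r) → Poly r
sumₚ zero    f = zeroₚ
sumₚ (suc k) f = f zero +ₚ sumₚ k (λ i → f (suc i))

monoSubst : ∀ {r s} → Vec ℕ r → (Fin r → Poly s) → Poly s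
monoSubst []       σ = constₚ 1ℚ
monoSubst (e ∷ es) σ = (σ zero ^ₚ e) *ₚ monoSubst es (λ i → σ (suc i))

substₚ : ∀ {r s} → Poly r → (Fin r → Poly s) → Poly s
substₚ [] σ = zeroₚ
substₚ ((c , α) ∷ p) σ = scaleₚ c (monoSubst α σ) +ₚ substₚ p σ

Odd : ℕ → Set
Odd n = n % 2 ≡ 1

odd? : (n : ℕ) → Dec (Odd n)
odd? n = (n % 2) ℕ.≟ 1

InS : ∀ {r} → ℕ → Vec ℕ r → Set
InS N n = (V.sum n ≡ N) × VAll.All (λ k → (3 ≤ k) × Odd k) n

inS? : ∀ {r} (N : ℕ) (n : Vec ℕ r) → Dec (InS N n)
inS? N n = (V.sum n ℕ.≟ N) ×-dec VAll.all? (λ k → (3 ℕ.≤? k) ×-dec odd? k) n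

vecsUpTo : ℕ → (r : ℕ) → List (Vec ℕ r)
vecsUpTo B zero    = [] ∷ []
vecsUpTo B (suc r) =
  L.concatMap (λ k → L.map (k ∷_) (vecsUpTo B r)) (L.upTo (suc B))

-- S_{N,r} as a duplicate-free list (entries of elements of S_{N,r} are ≤ N)
Slist : ℕ → (r : ℕ) → List (Vec ℕ r)
Slist N r = L.filter (inS? N) (vecsUpTo N r)

sumS : (N r : ℕ) → (Vec ℕ r → ℚ) → ℚ
sumS N r f = L.foldr _+_ 0ℚ (L.map f (Slist N r))

minus1 : ∀ {r} → Vec ℕ r → Vec ℕ r
minus1 = V.map pred

InV : ∀ {r} → ℕ → Poly r → Set
InV N P = ∀ β → ¬ (coeff P β ≡ 0ℚ) → InS N (V.map suc β)

π : ∀ {r} → Poly r → Vec ℕ r → ℚ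
π P n = coeff P (minus1 n)

σW₁ : ∀ {k} → Fin (suc (suc k)) → Poly (suc (suc k))
σW₁ zero          = var (suc zero) -ₚ var zero
σW₁ (suc zero)    = var (suc zero)
σW₁ (suc (suc i)) = var (suc (suc i))

σW₂ : ∀ {k} → Fin (suc (suc k)) → Poly (suc (suc k))
σW₂ zero          = var (suc zero) -ₚ var zero
σW₂ (suc zero)    = var zero
σW₂ (suc (suc i)) = var (suc (suc i))

-- P ∈ W_{N,r}   (r ≥ 2 so that x₂ exists)
InW : ∀ {k} → ℕ → Poly (suc (suc k)) → Set
InW N P = InV N P × (P ≈ₚ (substₚ P σW₁ -ₚ substₚ P σW₂))

-- The operator ∘, for f = x^a a monomial in one variable (deg f = a)
-- and g a polynomial in k variables; the result has k+1 variables.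

signPow : ℕ → ℚ
signPow zero    = 1ℚ
signPow (suc a) = - signPow a

circ : ∀ {k} → (a : ℕ) → Poly k → Poly (suc k)
circ {k} a g =
  (X zero ^ₚ a) *ₚ substₚ g (λ j → X (suc j))
  +ₚ sumₚ k (λ i →
       ((X (suc i) -ₚ X (inject₁ i)) ^ₚ a) *ₚ substₚ g (λ j → X (punchIn (suc i) j))
       -ₚ scaleₚ (signPow a)
            (((X (inject₁ i) -ₚ X (suc i)) ^ₚ a) *ₚ substₚ g (λ j → X (punchIn (inject₁ i) j))))
  where
  X : Fin (suc k) → Poly (suc k)
  X = var

e : ∀ {k} → Vec ℕ (suc k) → Vec ℕ (suc k) → ℚ
e (m₁ ∷ ms) n = coeff (circ (pred m₁) (mono (minus1 ms))) (minus1 n)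

δ : ∀ {r} → Vec ℕ r → Vec ℕ r → ℚ
δ m n with ≡-dec ℕ._≟_ m n
... | yes _ = 1ℚ
... | no  _ = 0ℚ

E : ∀ {k} → Vec ℕ (suc k) → Vec ℕ (suc k) → ℚ
E = e

-- E^{(j)} for size a + j, with j = suc j' (so a = r - j):
-- entry δ_{(m₁..m_a),(n₁..n_a)} · e(m_{a+1..r} ; n_{a+1..r})
Eʲ : ∀ a {j'} → Vec ℕ (a ℕ.+ suc j') → Vec ℕ (a ℕ.+ suc j') → ℚ
Eʲ a m n = δ (V.take a m) (V.take a n) * e (V.drop a m) (V.drop a n)

F : ∀ {k} → Vec ℕ (suc k) → Vec ℕ (suc k) → ℚ
F m n = E m n - δ m n

rowMul : (N r : ℕ) → (Vec ℕ r → ℚ) → (Vec ℕ r → Vec ℕ r → ℚ) → Vec ℕ r → ℚ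
rowMul N r v M n = sumS N r (λ m → v m * M m n)

module Submission where

-- Since F = E - id the claim is π(P)E + π(P)E^{(r-1)} = π(P).  Row m of E is
-- the coefficient vector of G(m) = x₁^{m₁-1} ∘ x^{m'-1}, row m of E^{(r-1)}
-- that of G'(m) = x₁^{m₁-1}(x^{m₂-1} ∘ x^{m''-1}), so the claim is the
-- polynomial identity  linExt G P + linExt G' P = P  for the linear
-- extensions.  Expanding ∘, linExt G P = P + Σ_i (P∘A_i - P∘B_i), where A_i,
-- B_i put x_{i+1} - x_i first and omit x_{i+1}, resp. x_i; linExt G' P is the
-- same with x₁ kept first.  The i = 0 term is -P by the W-relation, and the
-- other terms cancel in pairs since the W-relation makes P antisymmetric in
-- its first two variables.

open import Defs
open import Data.Nat as ℕ using (ℕ; zero; suc; pred; _≤_; _<_; z≤n; s≤s)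
import Data.Nat.Properties as NP
open import Data.Rational as ℚ using (ℚ; 0ℚ; 1ℚ; _+_; _*_; -_; _-_)
import Data.Rational.Properties as QP
open import Data.Rational.Solver using (module +-*-Solver)
open import Data.Fin using (Fin; zero; suc; inject₁; punchIn)
open import Data.Vec as V using (Vec; []; _∷_)
open import Data.Vec.Properties using (≡-dec)
open import Data.Vec.Relation.Unary.All as VAll using ([]; _∷_)
open import Data.List as L using (List; []; _∷_; _++_)
import Data.List.Properties as LP
open import Data.Product using (_×_; _,_; proj₁; proj₂)
open import Relation.Binary.Bundles using (Setoid)
import Relation.Binary.Reasoning.Setoid as SetoidReasoning
open import Relation.Binary.PropositionalEquality
open import Relation.Nullary using (Dec; yes; no; ¬_)
open import Data.Empty using (⊥-elim)

open +-*-Solver using (solve; con; _:+_; _:*_; :-_; _:-_; _:=_)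

-- Equality of polynomials: all coefficients agree (the relation _≈ₚ_ of
-- Defs, packaged as a record so that the polynomials can be inferred).
infix 4 _≈_
record _≈_ {r} (p q : Poly r) : Set where
  constructor mk≈
  field ≈-at : ∀ β → coeff p β ≡ coeff q β
open _≈_ public

≈-refl : ∀ {r} {p : Poly r} → p ≈ p
≈-refl = mk≈ λ β → refl

≈-sym : ∀ {r} {p q : Poly r} → p ≈ q → q ≈ p
≈-sym e = mk≈ λ β → sym (≈-at e β)

≈-trans : ∀ {r} {p q s : Poly r} → p ≈ q → q ≈ s → p ≈ s
≈-trans e f = mk≈ λ β → trans (≈-at e β) (≈-at f β)

≈-setoid : ℕ → Setoid _ _
≈-setoid r = record
  { Carrier = Poly r ; _≈_ = _≈_
  ; isEquivalence = record { refl = ≈-refl ; sym = ≈-sym ; trans = ≈-trans } }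

≡⇒≈ : ∀ {r} {p q : Poly r} → p ≡ q → p ≈ q
≡⇒≈ refl = ≈-refl

indicator : ∀ {r} → Vec ℕ r → Vec ℕ r → ℚ
indicator β α with ≡-dec ℕ._≟_ α β
... | yes _ = 1ℚ
... | no _ = 0ℚ

indicator-≡ : ∀ {r} (α β : Vec ℕ r) → α ≡ β → indicator β α ≡ 1ℚ
indicator-≡ α β e with ≡-dec ℕ._≟_ α β
... | yes _ = refl
... | no ne = ⊥-elim (ne e)

indicator-≢ : ∀ {r} (α β : Vec ℕ r) → ¬ (α ≡ β) → indicator β α ≡ 0ℚ
indicator-≢ α β ne with ≡-dec ℕ._≟_ α β
... | yes e = ⊥-elim (ne e)
... | no _ = refl

-- Every identity between
-- polynomials below is proved by comparing such functionals.
ev : ∀ {r} → (Vec ℕ r → ℚ) → Poly r → ℚ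
ev h [] = 0ℚ
ev h ((c , α) ∷ p) = c * h α + ev h p

coeff-ev : ∀ {r} (p : Poly r) β → coeff p β ≡ ev (indicator β) p
coeff-ev [] β = refl
coeff-ev ((c , α) ∷ p) β with ≡-dec ℕ._≟_ α β
... | yes _ = cong₂ _+_ (sym (QP.*-identityʳ c)) (coeff-ev p β)
... | no _ = trans (coeff-ev p β)
                   (sym (trans (cong (_+ ev (indicator β) p) (QP.*-zeroʳ c)) (QP.+-identityˡ _)))

ev-++ : ∀ {r} (h : Vec ℕ r → ℚ) p q → ev h (p ++ q) ≡ ev h p + ev h q
ev-++ h [] q = sym (QP.+-identityˡ _)
ev-++ h ((c , α) ∷ p) q =
  trans (cong (c * h α +_) (ev-++ h p q)) (sym (QP.+-assoc (c * h α) (ev h p) (ev h q)))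

ev-neg : ∀ {r} (h : Vec ℕ r → ℚ) p → ev h (-ₚ p) ≡ - ev h p
ev-neg h [] = refl
ev-neg h ((c , α) ∷ p) = trans (cong ((- c) * h α +_) (ev-neg h p))
  (solve 3 (λ c x y → (:- c) :* x :+ (:- y) := :- (c :* x :+ y)) refl c (h α) (ev h p))

ev-scale : ∀ {r} (h : Vec ℕ r → ℚ) c p → ev h (scaleₚ c p) ≡ c * ev h p
ev-scale h c [] = sym (QP.*-zeroʳ c)
ev-scale h c ((d , α) ∷ p) = trans (cong ((c * d) * h α +_) (ev-scale h c p))
  (solve 4 (λ c d x y → c :* d :* x :+ c :* y := c :* (d :* x :+ y)) refl c d (h α) (ev h p))

ev-congʰ : ∀ {r} {h h' : Vec ℕ r → ℚ} p → (∀ α → h α ≡ h' α) → ev h p ≡ ev h' p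
ev-congʰ [] e = refl
ev-congʰ ((c , α) ∷ p) e = cong₂ (λ x y → c * x + y) (e α) (ev-congʰ p e)

ev-+ʰ : ∀ {r} (h h' : Vec ℕ r → ℚ) p → ev (λ α → h α + h' α) p ≡ ev h p + ev h' p
ev-+ʰ h h' [] = sym (QP.+-identityˡ _)
ev-+ʰ h h' ((c , α) ∷ p) = trans (cong (c * (h α + h' α) +_) (ev-+ʰ h h' p))
  (solve 5 (λ c x y u v → c :* (x :+ y) :+ (u :+ v) := (c :* x :+ u) :+ (c :* y :+ v))
         refl c (h α) (h' α) (ev h p) (ev h' p))

ev-*ʰ : ∀ {r} (h : Vec ℕ r → ℚ) c p → ev (λ α → c * h α) p ≡ c * ev h p
ev-*ʰ h c [] = sym (QP.*-zeroʳ c)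
ev-*ʰ h c ((d , α) ∷ p) = trans (cong (d * (c * h α) +_) (ev-*ʰ h c p))
  (solve 4 (λ c d x y → d :* (c :* x) :+ c :* y := c :* (d :* x :+ y)) refl c d (h α) (ev h p))

ev-negʰ : ∀ {r} (h : Vec ℕ r → ℚ) p → ev (λ α → - h α) p ≡ - ev h p
ev-negʰ h p = begin
  ev (λ α → - h α) p          ≡⟨ ev-congʰ p (λ α → solve 1 (λ x → :- x := con (- 1ℚ) :* x) refl (h α)) ⟩
  ev (λ α → - 1ℚ * h α) p     ≡⟨ ev-*ʰ h (- 1ℚ) p ⟩
  - 1ℚ * ev h p               ≡⟨ solve 1 (λ x → con (- 1ℚ) :* x := :- x) refl (ev h p) ⟩
  - ev h p                    ∎
  where open ≡-Reasoning

ev-0ʰ : ∀ {r} p → ev {r} (λ _ → 0ℚ) p ≡ 0ℚ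
ev-0ʰ [] = refl
ev-0ʰ ((c , α) ∷ p) = trans (cong (c * 0ℚ +_) (ev-0ʰ p)) (trans (QP.+-identityʳ _) (QP.*-zeroʳ c))

ev-swap : ∀ {r s} (k : Vec ℕ r → Vec ℕ s → ℚ) p q →
  ev (λ α → ev (k α) q) p ≡ ev (λ β → ev (λ α → k α β) p) q
ev-swap k [] q = sym (ev-0ʰ q)
ev-swap k ((c , α) ∷ p) q = trans (cong (c * ev (k α) q +_) (ev-swap k p q))
  (sym (trans (ev-+ʰ (λ β → c * k α β) (λ β → ev (λ α → k α β) p) q)
    (cong (_+ ev (λ β → ev (λ α₁ → k α₁ β) p) q) (ev-*ʰ (k α) c q))))

-- dropTerms α p deletes every term of p with exponent α.  It is the tool
-- for the one non-formal fact about ev: it respects ≈ (ev-cong), proved by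
-- peeling off one exponent at a time.
dropTerms : ∀ {r} → Vec ℕ r → Poly r → Poly r
dropTerms α [] = []
dropTerms α ((c , β) ∷ p) with ≡-dec ℕ._≟_ β α
... | yes _ = dropTerms α p
... | no _ = (c , β) ∷ dropTerms α p

ev-split : ∀ {r} (h : Vec ℕ r → ℚ) α p → ev h p ≡ coeff p α * h α + ev h (dropTerms α p)
ev-split h α [] = sym (trans (QP.+-identityʳ (0ℚ * h α)) (QP.*-zeroˡ (h α)))
ev-split h α ((c , β) ∷ p) with ≡-dec ℕ._≟_ β α
... | yes refl = trans (cong (c * h β +_) (ev-split h β p))
      (solve 4 (λ c x y z → c :* x :+ (y :* x :+ z) := (c :+ y) :* x :+ z)
             refl c (h β) (coeff p β) (ev h (dropTerms β p)))
... | no _ = trans (cong (c * h β +_) (ev-split h α p))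
      (solve 5 (λ c x y w z → c :* x :+ (y :* w :+ z) := y :* w :+ (c :* x :+ z))
             refl c (h β) (coeff p α) (h α) (ev h (dropTerms α p)))

dropTerms-coeff-same : ∀ {r} (α : Vec ℕ r) p → coeff (dropTerms α p) α ≡ 0ℚ
dropTerms-coeff-same α [] = refl
dropTerms-coeff-same α ((c , β) ∷ p) with ≡-dec ℕ._≟_ β α
... | yes _ = dropTerms-coeff-same α p
... | no ne with ≡-dec ℕ._≟_ β α
...   | yes e = ⊥-elim (ne e)
...   | no _ = dropTerms-coeff-same α p

dropTerms-coeff-other : ∀ {r} (α γ : Vec ℕ r) p → ¬ (γ ≡ α) →
  coeff (dropTerms α p) γ ≡ coeff p γ
dropTerms-coeff-other α γ [] ne = refl
dropTerms-coeff-other α γ ((c , β) ∷ p) ne with ≡-dec ℕ._≟_ β α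
dropTerms-coeff-other α γ ((c , β) ∷ p) ne | yes refl with ≡-dec ℕ._≟_ β γ
... | yes e = ⊥-elim (ne (sym e))
... | no _ = dropTerms-coeff-other α γ p ne
dropTerms-coeff-other α γ ((c , β) ∷ p) ne | no _ with ≡-dec ℕ._≟_ β γ
... | yes _ = cong (c +_) (dropTerms-coeff-other α γ p ne)
... | no _ = dropTerms-coeff-other α γ p ne

dropTerms-length : ∀ {r} (α : Vec ℕ r) p → L.length (dropTerms α p) ≤ L.length p
dropTerms-length α [] = z≤n
dropTerms-length α ((c , β) ∷ p) with ≡-dec ℕ._≟_ β α
... | yes _ = NP.m≤n⇒m≤1+n (dropTerms-length α p)
... | no _ = s≤s (dropTerms-length α p)

dropTerms-head : ∀ {r} (α : Vec ℕ r) c p → L.length (dropTerms α ((c , α) ∷ p)) ≤ L.length p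
dropTerms-head α c p with ≡-dec ℕ._≟_ α α
... | yes _ = dropTerms-length α p
... | no ne = ⊥-elim (ne refl)

dropTerms-zero : ∀ {r} (α : Vec ℕ r) p → (∀ β → coeff p β ≡ 0ℚ) →
  ∀ β → coeff (dropTerms α p) β ≡ 0ℚ
dropTerms-zero α p z β with ≡-dec ℕ._≟_ β α
... | yes refl = dropTerms-coeff-same β p
... | no ne = trans (dropTerms-coeff-other α β p ne) (z β)

ev-zero : ∀ {r} (h : Vec ℕ r → ℚ) n p → L.length p ≤ n → (∀ β → coeff p β ≡ 0ℚ) → ev h p ≡ 0ℚ
ev-zero h n [] l z = refl
ev-zero h (suc n) ((c , α) ∷ p) (s≤s l) z = begin
  ev h q                                        ≡⟨ ev-split h α q ⟩
  coeff q α * h α + ev h (dropTerms α q)        ≡⟨ cong₂ (λ x y → x * h α + y) (z α) rest ⟩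
  0ℚ * h α + 0ℚ                                 ≡⟨ trans (QP.+-identityʳ _) (QP.*-zeroˡ (h α)) ⟩
  0ℚ                                            ∎
  where
  open ≡-Reasoning
  q : Poly _
  q = (c , α) ∷ p
  rest : ev h (dropTerms α q) ≡ 0ℚ
  rest = ev-zero h n (dropTerms α q) (NP.≤-trans (dropTerms-head α c p) l) (dropTerms-zero α q z)

coeff-++ : ∀ {r} (p q : Poly r) β → coeff (p ++ q) β ≡ coeff p β + coeff q β
coeff-++ p q β = trans (coeff-ev (p ++ q) β)
  (trans (ev-++ (indicator β) p q) (sym (cong₂ _+_ (coeff-ev p β) (coeff-ev q β))))

coeff-neg : ∀ {r} (p : Poly r) β → coeff (-ₚ p) β ≡ - coeff p β
coeff-neg p β = trans (coeff-ev (-ₚ p) β)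
  (trans (ev-neg (indicator β) p) (cong -_ (sym (coeff-ev p β))))

coeff-- : ∀ {r} (p q : Poly r) β → coeff (p -ₚ q) β ≡ coeff p β - coeff q β
coeff-- p q β = trans (coeff-++ p (-ₚ q) β) (cong (coeff p β +_) (coeff-neg q β))

coeff-scale : ∀ {r} c (p : Poly r) β → coeff (scaleₚ c p) β ≡ c * coeff p β
coeff-scale c p β = trans (coeff-ev (scaleₚ c p) β)
  (trans (ev-scale (indicator β) c p) (cong (c *_) (sym (coeff-ev p β))))

-- Every functional respects ≈: apply ev-zero to p - q.
ev-cong : ∀ {r} (h : Vec ℕ r → ℚ) {p q} → p ≈ q → ev h p ≡ ev h q
ev-cong h {p} {q} e = difference-zero (begin
  ev h p - ev h q      ≡⟨ sym (trans (ev-++ h p (-ₚ q)) (cong (ev h p +_) (ev-neg h q))) ⟩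
  ev h (p -ₚ q)        ≡⟨ ev-zero h _ (p -ₚ q) NP.≤-refl p-q≈0 ⟩
  0ℚ                   ∎)
  where
  open ≡-Reasoning
  p-q≈0 : ∀ β → coeff (p -ₚ q) β ≡ 0ℚ
  p-q≈0 β = trans (coeff-- p q β)
    (trans (cong (_- coeff q β) (≈-at e β)) (QP.+-inverseʳ (coeff q β)))
  difference-zero : ∀ {a b} → a - b ≡ 0ℚ → a ≡ b
  difference-zero {a} {b} d = trans (solve 2 (λ a b → a := (a :- b) :+ b) refl a b)
    (trans (cong (_+ b) d) (QP.+-identityˡ b))

≈-ev : ∀ {r} (p q : Poly r) → (∀ h → ev h p ≡ ev h q) → p ≈ q
≈-ev p q e = mk≈ λ β → trans (coeff-ev p β) (trans (e (indicator β)) (sym (coeff-ev q β)))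

infixl 6 _⊕_
_⊕_ : ∀ {r} → Vec ℕ r → Vec ℕ r → Vec ℕ r
_⊕_ = V.zipWith ℕ._+_

⊕-comm : ∀ {r} (a b : Vec ℕ r) → a ⊕ b ≡ b ⊕ a
⊕-comm [] [] = refl
⊕-comm (x ∷ a) (y ∷ b) = cong₂ _∷_ (NP.+-comm x y) (⊕-comm a b)

⊕-assoc : ∀ {r} (a b c : Vec ℕ r) → (a ⊕ b) ⊕ c ≡ a ⊕ (b ⊕ c)
⊕-assoc [] [] [] = refl
⊕-assoc (x ∷ a) (y ∷ b) (z ∷ c) = cong₂ _∷_ (NP.+-assoc x y z) (⊕-assoc a b c)

⊕-identityˡ : ∀ {r} (a : Vec ℕ r) → V.replicate r 0 ⊕ a ≡ a
⊕-identityˡ [] = refl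
⊕-identityˡ (x ∷ a) = cong (x ∷_) (⊕-identityˡ a)

-- linExt G p = Σ_{(c , α) ∈ p} c · G α : the linear extension of a map G
-- defined on monomials.  Products and substitutions are instances.
linExt : ∀ {r s} → (Vec ℕ r → Poly s) → Poly r → Poly s
linExt G [] = []
linExt G ((c , α) ∷ p) = scaleₚ c (G α) ++ linExt G p

ev-linExt : ∀ {r s} (h : Vec ℕ s → ℚ) (G : Vec ℕ r → Poly s) p →
  ev h (linExt G p) ≡ ev (λ α → ev h (G α)) p
ev-linExt h G [] = refl
ev-linExt h G ((c , α) ∷ p) = trans (ev-++ h (scaleₚ c (G α)) (linExt G p))
  (cong₂ _+_ (ev-scale h c (G α)) (ev-linExt h G p))

coeff-linExt : ∀ {r s} (G : Vec ℕ r → Poly s) p γ →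
  coeff (linExt G p) γ ≡ ev (λ α → coeff (G α) γ) p
coeff-linExt G p γ = trans (coeff-ev (linExt G p) γ)
  (trans (ev-linExt (indicator γ) G p) (ev-congʰ p (λ α → sym (coeff-ev (G α) γ))))

linExt-congᴳ : ∀ {r s} {G G' : Vec ℕ r → Poly s} p → (∀ α → G α ≈ G' α) → linExt G p ≈ linExt G' p
linExt-congᴳ {G = G} {G'} p e = ≈-ev (linExt G p) (linExt G' p) λ h →
  trans (ev-linExt h G p) (trans (ev-congʰ p (λ α → ev-cong h (e α))) (sym (ev-linExt h G' p)))

shiftBy : ∀ {r} → Vec ℕ r → Poly r → Poly r
shiftBy α q = L.map (λ { (d , β) → (d , α ⊕ β) }) q

scale-shiftBy : ∀ {r} c (α : Vec ℕ r) q →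
  scaleₚ c (shiftBy α q) ≡ L.map (λ { (d , β) → (c * d , V.zipWith ℕ._+_ α β) }) q
scale-shiftBy c α [] = refl
scale-shiftBy c α ((d , β) ∷ q) = cong ((c * d , α ⊕ β) ∷_) (scale-shiftBy c α q)

*-as-linExt : ∀ {r} (p q : Poly r) → p *ₚ q ≡ linExt (λ α → shiftBy α q) p
*-as-linExt [] q = refl
*-as-linExt ((c , α) ∷ p) q = cong₂ _++_ (sym (scale-shiftBy c α q)) (*-as-linExt p q)

ev-shiftBy : ∀ {r} (h : Vec ℕ r → ℚ) α q → ev h (shiftBy α q) ≡ ev (λ β → h (α ⊕ β)) q
ev-shiftBy h α [] = refl
ev-shiftBy h α ((d , β) ∷ q) = cong (d * h (α ⊕ β) +_) (ev-shiftBy h α q)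

ev-* : ∀ {r} (h : Vec ℕ r → ℚ) p q → ev h (p *ₚ q) ≡ ev (λ α → ev (λ β → h (α ⊕ β)) q) p
ev-* h p q = trans (cong (ev h) (*-as-linExt p q))
  (trans (ev-linExt h _ p) (ev-congʰ p (λ α → ev-shiftBy h α q)))

+-cong : ∀ {r} {p p' q q' : Poly r} → p ≈ p' → q ≈ q' → p ++ q ≈ p' ++ q'
+-cong {p = p} {p'} {q} {q'} e f = mk≈ λ β →
  trans (coeff-++ p q β) (trans (cong₂ _+_ (≈-at e β) (≈-at f β)) (sym (coeff-++ p' q' β)))

neg-cong : ∀ {r} {p q : Poly r} → p ≈ q → -ₚ p ≈ -ₚ q
neg-cong {p = p} {q} e = mk≈ λ β →
  trans (coeff-neg p β) (trans (cong -_ (≈-at e β)) (sym (coeff-neg q β)))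

scale-cong : ∀ {r} c {p q : Poly r} → p ≈ q → scaleₚ c p ≈ scaleₚ c q
scale-cong c {p} {q} e = mk≈ λ β →
  trans (coeff-scale c p β) (trans (cong (c *_) (≈-at e β)) (sym (coeff-scale c q β)))

*-congˡ : ∀ {r} {p p' : Poly r} q → p ≈ p' → p *ₚ q ≈ p' *ₚ q
*-congˡ {p = p} {p'} q e = ≈-ev (p *ₚ q) (p' *ₚ q) λ h →
  trans (ev-* h p q) (trans (ev-cong _ e) (sym (ev-* h p' q)))

*-comm : ∀ {r} (p q : Poly r) → p *ₚ q ≈ q *ₚ p
*-comm p q = ≈-ev (p *ₚ q) (q *ₚ p) λ h → trans (ev-* h p q)
  (trans (ev-swap (λ α β → h (α ⊕ β)) p q)
  (trans (ev-congʰ q (λ β → ev-congʰ p (λ α → cong h (⊕-comm α β)))) (sym (ev-* h q p))))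

*-congʳ : ∀ {r} p {q q' : Poly r} → q ≈ q' → p *ₚ q ≈ p *ₚ q'
*-congʳ p {q} {q'} e = ≈-trans (*-comm p q) (≈-trans (*-congˡ p e) (*-comm q' p))

*-cong : ∀ {r} {p p' q q' : Poly r} → p ≈ p' → q ≈ q' → p *ₚ q ≈ p' *ₚ q'
*-cong {p' = p'} {q = q} e f = ≈-trans (*-congˡ q e) (*-congʳ p' f)

*-assoc : ∀ {r} (p q s : Poly r) → (p *ₚ q) *ₚ s ≈ p *ₚ (q *ₚ s)
*-assoc p q s = ≈-ev ((p *ₚ q) *ₚ s) (p *ₚ (q *ₚ s)) λ h → trans (ev-* h (p *ₚ q) s)
  (trans (ev-* _ p q)
  (trans (ev-congʰ p (λ α → ev-congʰ q (λ β → ev-congʰ s (λ δ → cong h (⊕-assoc α β δ)))))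
  (sym (trans (ev-* h p (q *ₚ s)) (ev-congʰ p (λ α → ev-* _ q s))))))

*-distribʳ : ∀ {r} (p q s : Poly r) → (p ++ q) *ₚ s ≈ (p *ₚ s) ++ (q *ₚ s)
*-distribʳ p q s = ≈-ev ((p ++ q) *ₚ s) ((p *ₚ s) ++ (q *ₚ s)) λ h →
  trans (ev-* h (p ++ q) s) (trans (ev-++ _ p q)
  (sym (trans (ev-++ h (p *ₚ s) (q *ₚ s)) (cong₂ _+_ (ev-* h p s) (ev-* h q s)))))

*-distribˡ : ∀ {r} (p q s : Poly r) → p *ₚ (q ++ s) ≈ (p *ₚ q) ++ (p *ₚ s)
*-distribˡ p q s = ≈-trans (*-comm p (q ++ s))
  (≈-trans (*-distribʳ q s p) (+-cong (*-comm q p) (*-comm s p)))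

*-scaleˡ : ∀ {r} c (p q : Poly r) → scaleₚ c p *ₚ q ≈ scaleₚ c (p *ₚ q)
*-scaleˡ c p q = ≈-ev (scaleₚ c p *ₚ q) (scaleₚ c (p *ₚ q)) λ h →
  trans (ev-* h (scaleₚ c p) q) (trans (ev-scale _ c p)
  (sym (trans (ev-scale h c (p *ₚ q)) (cong (c *_) (ev-* h p q)))))

*-scaleʳ : ∀ {r} c (p q : Poly r) → p *ₚ scaleₚ c q ≈ scaleₚ c (p *ₚ q)
*-scaleʳ c p q = ≈-trans (*-comm p (scaleₚ c q)) (≈-trans (*-scaleˡ c q p) (scale-cong c (*-comm q p)))

*-negˡ : ∀ {r} (p q : Poly r) → (-ₚ p) *ₚ q ≈ -ₚ (p *ₚ q)
*-negˡ p q = ≈-ev ((-ₚ p) *ₚ q) (-ₚ (p *ₚ q)) λ h →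
  trans (ev-* h (-ₚ p) q) (trans (ev-neg _ p) (sym (trans (ev-neg h (p *ₚ q)) (cong -_ (ev-* h p q)))))

*-negʳ : ∀ {r} (p q : Poly r) → p *ₚ (-ₚ q) ≈ -ₚ (p *ₚ q)
*-negʳ p q = ≈-trans (*-comm p (-ₚ q)) (≈-trans (*-negˡ q p) (neg-cong (*-comm q p)))

ev-mono : ∀ {r} (h : Vec ℕ r → ℚ) α → ev h (mono α) ≡ h α
ev-mono h α = solve 1 (λ x → con 1ℚ :* x :+ con 0ℚ := x) refl (h α)

*-identityˡ : ∀ {r} (p : Poly r) → constₚ 1ℚ *ₚ p ≈ p
*-identityˡ {r} p = ≈-ev (constₚ 1ℚ *ₚ p) p λ h → trans (ev-* h (constₚ 1ℚ) p)
  (trans (ev-mono (λ α → ev (λ β → h (α ⊕ β)) p) (V.replicate r 0)) (ev-congʰ p (λ β → cong h (⊕-identityˡ β))))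

*-identityʳ : ∀ {r} (p : Poly r) → p *ₚ constₚ 1ℚ ≈ p
*-identityʳ p = ≈-trans (*-comm p _) (*-identityˡ p)

*-interchange : ∀ {r} (a b c d : Poly r) → (a *ₚ b) *ₚ (c *ₚ d) ≈ (a *ₚ c) *ₚ (b *ₚ d)
*-interchange a b c d = ≈-trans (*-assoc a b (c *ₚ d))
  (≈-trans (*-congʳ a (≈-trans (≈-sym (*-assoc b c d)) (≈-trans (*-congˡ d (*-comm b c)) (*-assoc c b d))))
  (≈-sym (*-assoc a c (b *ₚ d))))

mono-* : ∀ {r} (a b : Vec ℕ r) → mono a *ₚ mono b ≈ mono (a ⊕ b)
mono-* a b = ≈-ev (mono a *ₚ mono b) (mono (a ⊕ b)) λ h → trans (ev-* h (mono a) (mono b))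
  (trans (ev-mono (λ α → ev (λ β → h (α ⊕ β)) (mono b)) a) (trans (ev-mono (λ β → h (a ⊕ β)) b) (sym (ev-mono h (a ⊕ b)))))

scale-scale : ∀ {r} c d (q : Poly r) → scaleₚ c (scaleₚ d q) ≈ scaleₚ (c * d) q
scale-scale c d q = mk≈ λ β → trans (coeff-scale c (scaleₚ d q) β) (trans (cong (c *_) (coeff-scale d q β))
  (trans (sym (QP.*-assoc c d _)) (sym (coeff-scale (c * d) q β))))

scale-one : ∀ {r} (q : Poly r) → scaleₚ 1ℚ q ≈ q
scale-one q = mk≈ λ β → trans (coeff-scale 1ℚ q β) (QP.*-identityˡ _)

scale-neg : ∀ {r} c (q : Poly r) → scaleₚ c (-ₚ q) ≈ scaleₚ (- c) q
scale-neg c q = mk≈ λ β → trans (coeff-scale c (-ₚ q) β) (trans (cong (c *_) (coeff-neg q β))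
  (trans (solve 2 (λ c x → c :* (:- x) := (:- c) :* x) refl c (coeff q β)) (sym (coeff-scale (- c) q β))))

^-cong : ∀ {r} {p q : Poly r} a → p ≈ q → p ^ₚ a ≈ q ^ₚ a
^-cong zero e = ≈-refl
^-cong (suc a) e = *-cong e (^-cong a e)

^-+ : ∀ {r} (p : Poly r) a b → p ^ₚ (a ℕ.+ b) ≈ (p ^ₚ a) *ₚ (p ^ₚ b)
^-+ p zero b = ≈-sym (*-identityˡ _)
^-+ p (suc a) b = ≈-trans (*-congʳ p (^-+ p a b)) (≈-sym (*-assoc p _ _))

^-neg : ∀ {r} (p : Poly r) a → (-ₚ p) ^ₚ a ≈ scaleₚ (signPow a) (p ^ₚ a)
^-neg p zero = ≈-sym (scale-one _)
^-neg p (suc a) = ≈-trans (*-congʳ (-ₚ p) (^-neg p a)) (≈-trans (*-scaleʳ (signPow a) (-ₚ p) (p ^ₚ a))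
  (≈-trans (scale-cong (signPow a) (*-negˡ p (p ^ₚ a))) (scale-neg (signPow a) (p *ₚ (p ^ₚ a)))))

signPow² : ∀ a → signPow a * signPow a ≡ 1ℚ
signPow² zero = refl
signPow² (suc a) = trans (solve 1 (λ x → (:- x) :* (:- x) := x :* x) refl (signPow a)) (signPow² a)

_·v_ : ∀ {r} → ℕ → Vec ℕ r → Vec ℕ r
a ·v v = V.map (a ℕ.*_) v

0·v : ∀ {r} (v : Vec ℕ r) → 0 ·v v ≡ V.replicate r 0
0·v [] = refl
0·v (x ∷ v) = cong (0 ∷_) (0·v v)

suc·v : ∀ {r} a (v : Vec ℕ r) → suc a ·v v ≡ v ⊕ (a ·v v)
suc·v a [] = refl
suc·v a (x ∷ v) = cong (_ ∷_) (suc·v a v)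

·v0 : ∀ {r} a → a ·v V.replicate r 0 ≡ V.replicate r 0
·v0 {zero} a = refl
·v0 {suc r} a = cong₂ _∷_ (NP.*-zeroʳ a) (·v0 a)

mono-^ : ∀ {r} (v : Vec ℕ r) a → mono v ^ₚ a ≈ mono (a ·v v)
mono-^ v zero = ≡⇒≈ (cong mono (sym (0·v v)))
mono-^ v (suc a) = ≈-trans (*-congʳ (mono v) (mono-^ v a))
  (≈-trans (mono-* v (a ·v v)) (≡⇒≈ (cong mono (sym (suc·v a v)))))

-- Substitution P ↦ P(σ 0, σ 1, …) is the linear extension of
-- x^α ↦ Π_i (σ i)^{α_i}; hence it is additive, multiplicative and composes.
substₚ-as-linExt : ∀ {r s} (p : Poly r) (σ : Fin r → Poly s) →
  substₚ p σ ≡ linExt (λ α → monoSubst α σ) p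
substₚ-as-linExt [] σ = refl
substₚ-as-linExt ((c , α) ∷ p) σ = cong (scaleₚ c (monoSubst α σ) ++_) (substₚ-as-linExt p σ)

ev-subst : ∀ {r s} (h : Vec ℕ s → ℚ) (p : Poly r) σ →
  ev h (substₚ p σ) ≡ ev (λ α → ev h (monoSubst α σ)) p
ev-subst h p σ = trans (cong (ev h) (substₚ-as-linExt p σ)) (ev-linExt h _ p)

subst-cong : ∀ {r s} {p q : Poly r} (σ : Fin r → Poly s) → p ≈ q → substₚ p σ ≈ substₚ q σ
subst-cong {p = p} {q} σ e = ≈-ev (substₚ p σ) (substₚ q σ) λ h →
  trans (ev-subst h p σ) (trans (ev-cong _ e) (sym (ev-subst h q σ)))

subst-++ : ∀ {r s} (p q : Poly r) (σ : Fin r → Poly s) → substₚ (p ++ q) σ ≈ substₚ p σ ++ substₚ q σ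
subst-++ p q σ = ≈-ev _ _ λ h → trans (ev-subst h (p ++ q) σ) (trans (ev-++ _ p q)
  (sym (trans (ev-++ h (substₚ p σ) (substₚ q σ)) (cong₂ _+_ (ev-subst h p σ) (ev-subst h q σ)))))

subst-neg : ∀ {r s} (p : Poly r) (σ : Fin r → Poly s) → substₚ (-ₚ p) σ ≈ -ₚ (substₚ p σ)
subst-neg p σ = ≈-ev _ _ λ h → trans (ev-subst h (-ₚ p) σ) (trans (ev-neg _ p)
  (sym (trans (ev-neg h (substₚ p σ)) (cong -_ (ev-subst h p σ)))))

subst-- : ∀ {r s} (p q : Poly r) (σ : Fin r → Poly s) → substₚ (p -ₚ q) σ ≈ substₚ p σ -ₚ substₚ q σ
subst-- p q σ = ≈-trans (subst-++ p (-ₚ q) σ) (+-cong ≈-refl (subst-neg q σ))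

subst-mono : ∀ {r s} (β : Vec ℕ r) (σ : Fin r → Poly s) → substₚ (mono β) σ ≈ monoSubst β σ
subst-mono β σ = ≈-ev _ _ λ h → trans (ev-subst h (mono β) σ) (ev-mono (λ α → ev h (monoSubst α σ)) β)

monoSubst-congσ : ∀ {r s} (α : Vec ℕ r) {σ τ : Fin r → Poly s} → (∀ i → σ i ≈ τ i) →
  monoSubst α σ ≈ monoSubst α τ
monoSubst-congσ [] e = ≈-refl
monoSubst-congσ (a ∷ α) e = *-cong (^-cong a (e zero)) (monoSubst-congσ α (λ i → e (suc i)))

subst-congσ : ∀ {r s} (p : Poly r) {σ τ : Fin r → Poly s} → (∀ i → σ i ≈ τ i) → substₚ p σ ≈ substₚ p τ
subst-congσ p {σ} {τ} e = subst₂ _≈_ (sym (substₚ-as-linExt p σ)) (sym (substₚ-as-linExt p τ))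
  (linExt-congᴳ p (λ α → monoSubst-congσ α e))

monoSubst-⊕ : ∀ {r s} (α β : Vec ℕ r) (σ : Fin r → Poly s) →
  monoSubst (α ⊕ β) σ ≈ monoSubst α σ *ₚ monoSubst β σ
monoSubst-⊕ [] [] σ = ≈-sym (*-identityˡ _)
monoSubst-⊕ (a ∷ α) (b ∷ β) σ = ≈-trans (*-cong (^-+ (σ zero) a b) (monoSubst-⊕ α β (λ i → σ (suc i))))
  (*-interchange (σ zero ^ₚ a) (σ zero ^ₚ b) (monoSubst α (λ i → σ (suc i))) (monoSubst β (λ i → σ (suc i))))

linExt-* : ∀ {r s} (G : Vec ℕ r → Poly s) → (∀ α β → G (α ⊕ β) ≈ G α *ₚ G β) →
  ∀ p q → linExt G (p *ₚ q) ≈ linExt G p *ₚ linExt G q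
linExt-* G hom p q = ≈-ev _ _ λ h →
  trans (ev-linExt h G (p *ₚ q))
  (trans (ev-* _ p q)
  (trans (ev-congʰ p (λ α → ev-congʰ q (λ β → trans (ev-cong h (hom α β)) (ev-* h (G α) (G β)))))
  (sym (trans (ev-* h (linExt G p) (linExt G q))
       (trans (ev-linExt _ G p)
       (ev-congʰ p (λ α → trans (ev-congʰ (G α) (λ u → ev-linExt _ G q))
                          (ev-swap (λ u β → ev (λ v → h (u ⊕ v)) (G β)) (G α) q))))))))

subst-* : ∀ {r s} (p q : Poly r) (σ : Fin r → Poly s) → substₚ (p *ₚ q) σ ≈ substₚ p σ *ₚ substₚ q σ
subst-* p q σ = subst₂ _≈_ (sym (substₚ-as-linExt (p *ₚ q) σ))
  (sym (cong₂ _*ₚ_ (substₚ-as-linExt p σ) (substₚ-as-linExt q σ)))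
  (linExt-* (λ α → monoSubst α σ) (λ α β → monoSubst-⊕ α β σ) p q)

monoSubst-0 : ∀ {r s} (σ : Fin r → Poly s) → monoSubst (V.replicate r 0) σ ≈ constₚ 1ℚ
monoSubst-0 {zero} σ = ≈-refl
monoSubst-0 {suc r} σ = ≈-trans (*-identityˡ _) (monoSubst-0 (λ i → σ (suc i)))

subst-one : ∀ {r s} (σ : Fin r → Poly s) → substₚ (constₚ {r} 1ℚ) σ ≈ constₚ 1ℚ
subst-one {r} σ = ≈-trans (subst-mono (V.replicate r 0) σ) (monoSubst-0 σ)

subst-^ : ∀ {r s} (p : Poly r) a (σ : Fin r → Poly s) → substₚ (p ^ₚ a) σ ≈ (substₚ p σ) ^ₚ a
subst-^ p zero σ = subst-one σ
subst-^ p (suc a) σ = ≈-trans (subst-* p (p ^ₚ a) σ) (*-congʳ (substₚ p σ) (subst-^ p a σ))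

monoSubst-unit : ∀ {r s} (i : Fin r) (σ : Fin r → Poly s) → monoSubst (unitVec i) σ ≈ σ i
monoSubst-unit {suc r} zero σ =
  ≈-trans (*-cong (*-identityʳ (σ zero)) (monoSubst-0 (λ i → σ (suc i)))) (*-identityʳ _)
monoSubst-unit {suc r} (suc i) σ = ≈-trans (*-identityˡ _) (monoSubst-unit i (λ j → σ (suc j)))

subst-var : ∀ {r s} (i : Fin r) (σ : Fin r → Poly s) → substₚ (var i) σ ≈ σ i
subst-var i σ = ≈-trans (subst-mono (unitVec i) σ) (monoSubst-unit i σ)

subst-var-- : ∀ {r s} (i j : Fin r) (σ : Fin r → Poly s) → substₚ (var i -ₚ var j) σ ≈ σ i -ₚ σ j
subst-var-- i j σ = ≈-trans (subst-- (var i) (var j) σ) (+-cong (subst-var i σ) (neg-cong (subst-var j σ)))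

subst-linExt : ∀ {r s t} (G : Vec ℕ r → Poly s) (p : Poly r) (τ : Fin s → Poly t) →
  substₚ (linExt G p) τ ≈ linExt (λ α → substₚ (G α) τ) p
subst-linExt G p τ = ≈-ev _ _ λ h → trans (ev-subst h (linExt G p) τ) (trans (ev-linExt _ G p)
  (sym (trans (ev-linExt h _ p) (ev-congʰ p (λ α → ev-subst h (G α) τ)))))

monoSubst-subst : ∀ {r s t} (α : Vec ℕ r) (σ : Fin r → Poly s) (τ : Fin s → Poly t) →
  substₚ (monoSubst α σ) τ ≈ monoSubst α (λ i → substₚ (σ i) τ)
monoSubst-subst [] σ τ = subst-one τ
monoSubst-subst (a ∷ α) σ τ = ≈-trans (subst-* (σ zero ^ₚ a) (monoSubst α (λ i → σ (suc i))) τ)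
  (*-cong (subst-^ (σ zero) a τ) (monoSubst-subst α (λ i → σ (suc i)) τ))

subst-comp : ∀ {r s t} (p : Poly r) (σ : Fin r → Poly s) (τ : Fin s → Poly t) →
  substₚ (substₚ p σ) τ ≈ substₚ p (λ i → substₚ (σ i) τ)
subst-comp p σ τ = subst₂ _≈_ (cong (λ x → substₚ x τ) (sym (substₚ-as-linExt p σ)))
  (sym (substₚ-as-linExt p _))
  (≈-trans (subst-linExt _ p τ) (linExt-congᴳ p (λ α → monoSubst-subst α σ τ)))

combine : ∀ {k r} → Vec ℕ k → (Fin k → Vec ℕ r) → Vec ℕ r
combine {r = r} [] w = V.replicate r 0
combine (a ∷ α) w = (a ·v w zero) ⊕ combine α (λ i → w (suc i))

monoSubst-monos : ∀ {k r} (α : Vec ℕ k) (w : Fin k → Vec ℕ r) →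
  monoSubst α (λ i → mono (w i)) ≈ mono (combine α w)
monoSubst-monos [] w = ≈-refl
monoSubst-monos (a ∷ α) w = ≈-trans (*-cong (mono-^ (w zero) a) (monoSubst-monos α (λ i → w (suc i))))
  (mono-* (a ·v w zero) (combine α (λ i → w (suc i))))

combine-0∷ : ∀ {k r} (α : Vec ℕ k) (w : Fin k → Vec ℕ r) → combine α (λ i → 0 ∷ w i) ≡ 0 ∷ combine α w
combine-0∷ [] w = refl
combine-0∷ (b ∷ α) w rewrite combine-0∷ α (λ i → w (suc i)) =
  cong (_∷ ((b ·v w zero) ⊕ combine α (λ i → w (suc i)))) (trans (NP.+-identityʳ (b ℕ.* 0)) (NP.*-zeroʳ b))

combine-unitVec : ∀ {r} (α : Vec ℕ r) → combine α unitVec ≡ α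
combine-unitVec [] = refl
combine-unitVec {suc r} (a ∷ α)
  rewrite combine-0∷ α unitVec | combine-unitVec α | ·v0 {r} a | ⊕-identityˡ α =
  cong (_∷ α) (trans (NP.+-identityʳ (a ℕ.* 1)) (NP.*-identityʳ a))

subst-id : ∀ {r} (p : Poly r) → substₚ p var ≈ p
subst-id p = ≈-ev _ _ λ h → trans (ev-subst h p var) (ev-congʰ p λ α → begin
  ev h (monoSubst α var)          ≡⟨ ev-cong h (monoSubst-monos α unitVec) ⟩
  ev h (mono (combine α unitVec)) ≡⟨ ev-mono h _ ⟩
  h (combine α unitVec)           ≡⟨ cong h (combine-unitVec α) ⟩
  h α                             ∎)
  where open ≡-Reasoning

++-interchange : ∀ {r} (a b c d : Poly r) → (a ++ b) ++ (c ++ d) ≈ (a ++ c) ++ (b ++ d)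
++-interchange a b c d = ≈-ev _ _ λ h → begin
  ev h ((a ++ b) ++ (c ++ d))              ≡⟨ ev-++ h (a ++ b) (c ++ d) ⟩
  ev h (a ++ b) + ev h (c ++ d)            ≡⟨ cong₂ _+_ (ev-++ h a b) (ev-++ h c d) ⟩
  (ev h a + ev h b) + (ev h c + ev h d)    ≡⟨ solve 4 (λ a b c d → (a :+ b) :+ (c :+ d) := (a :+ c) :+ (b :+ d))
                                                    refl (ev h a) (ev h b) (ev h c) (ev h d) ⟩
  (ev h a + ev h c) + (ev h b + ev h d)    ≡⟨ sym (cong₂ _+_ (ev-++ h a c) (ev-++ h b d)) ⟩
  ev h (a ++ c) + ev h (b ++ d)            ≡⟨ sym (ev-++ h (a ++ c) (b ++ d)) ⟩
  ev h ((a ++ c) ++ (b ++ d))              ∎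
  where open ≡-Reasoning

sum-cong : ∀ {r} k {f g : Fin k → Poly r} → (∀ i → f i ≈ g i) → sumₚ k f ≈ sumₚ k g
sum-cong zero e = ≈-refl
sum-cong (suc k) e = +-cong (e zero) (sum-cong k (λ i → e (suc i)))

sum-++ : ∀ {r} k (f g : Fin k → Poly r) → sumₚ k f ++ sumₚ k g ≈ sumₚ k (λ i → f i ++ g i)
sum-++ zero f g = ≈-refl
sum-++ (suc k) f g = ≈-trans (++-interchange (f zero) _ (g zero) _)
  (+-cong ≈-refl (sum-++ k (λ i → f (suc i)) (λ i → g (suc i))))

sum-zero : ∀ {r} k (f : Fin k → Poly r) → (∀ i → f i ≈ []) → sumₚ k f ≈ []
sum-zero zero f e = ≈-refl
sum-zero (suc k) f e = +-cong (e zero) (sum-zero k (λ i → f (suc i)) (λ i → e (suc i)))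

*-zeroʳ : ∀ {r} (q : Poly r) → q *ₚ [] ≈ []
*-zeroʳ q = ≈-ev _ _ λ h → trans (ev-* h q []) (ev-0ʰ q)

*-sum : ∀ {r} (q : Poly r) k (f : Fin k → Poly r) → q *ₚ sumₚ k f ≈ sumₚ k (λ i → q *ₚ f i)
*-sum q zero f = *-zeroʳ q
*-sum q (suc k) f = ≈-trans (*-distribˡ q (f zero) (sumₚ k (λ i → f (suc i))))
  (+-cong ≈-refl (*-sum q k (λ i → f (suc i))))

subst-sum : ∀ {r s} k (f : Fin k → Poly r) (σ : Fin r → Poly s) →
  substₚ (sumₚ k f) σ ≈ sumₚ k (λ i → substₚ (f i) σ)
subst-sum zero f σ = ≈-refl
subst-sum (suc k) f σ = ≈-trans (subst-++ (f zero) _ σ) (+-cong ≈-refl (subst-sum k (λ i → f (suc i)) σ))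

linExt-++ᴳ : ∀ {r s} (G H : Vec ℕ r → Poly s) p → linExt (λ α → G α ++ H α) p ≈ linExt G p ++ linExt H p
linExt-++ᴳ G H p = ≈-ev _ _ λ h → trans (ev-linExt h _ p) (trans (ev-congʰ p (λ α → ev-++ h (G α) (H α)))
  (trans (ev-+ʰ _ _ p) (sym (trans (ev-++ h (linExt G p) (linExt H p))
    (cong₂ _+_ (ev-linExt h G p) (ev-linExt h H p))))))

linExt-negᴳ : ∀ {r s} (G : Vec ℕ r → Poly s) p → linExt (λ α → -ₚ G α) p ≈ -ₚ linExt G p
linExt-negᴳ G p = ≈-ev _ _ λ h → trans (ev-linExt h _ p) (trans (ev-congʰ p (λ α → ev-neg h (G α)))
  (trans (ev-negʰ (λ α → ev h (G α)) p) (sym (trans (ev-neg h (linExt G p)) (cong -_ (ev-linExt h G p))))))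

linExt-sumᴳ : ∀ {r s} k (H : Fin k → Vec ℕ r → Poly s) p →
  linExt (λ α → sumₚ k (λ i → H i α)) p ≈ sumₚ k (λ i → linExt (H i) p)
linExt-sumᴳ zero H p = ≈-ev _ _ λ h → trans (ev-linExt h _ p) (ev-0ʰ p)
linExt-sumᴳ (suc k) H p = ≈-trans (linExt-++ᴳ (H zero) (λ α → sumₚ k (λ i → H (suc i) α)) p)
  (+-cong ≈-refl (linExt-sumᴳ k (λ i → H (suc i)) p))

infixr 5 _∷σ_
_∷σ_ : ∀ {k s} → Poly s → (Fin k → Poly s) → Fin (suc k) → Poly s
(u ∷σ τ) zero = u
(u ∷σ τ) (suc j) = τ j

-- SubstSum θ θA θB α = x^α∘θ + Σ_i (x^α∘θA_i - x^α∘θB_i).  Both G and G'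
-- of the overview have this form, and then so do their linear extensions.
SubstSum : ∀ {r s} m → (Fin r → Poly s) → (Fin m → Fin r → Poly s) → (Fin m → Fin r → Poly s) →
  Vec ℕ r → Poly s
SubstSum m θ θA θB α = monoSubst α θ ++ sumₚ m (λ i → monoSubst α (θA i) -ₚ monoSubst α (θB i))

linExt-SubstSum : ∀ {r s} m θ θA θB (G : Vec ℕ r → Poly s) → (∀ α → G α ≈ SubstSum m θ θA θB α) →
  ∀ p → linExt G p ≈ substₚ p θ ++ sumₚ m (λ i → substₚ p (θA i) -ₚ substₚ p (θB i))
linExt-SubstSum m θ θA θB G e p =
  ≈-trans (linExt-congᴳ p e)
  (≈-trans (linExt-++ᴳ _ _ p)
  (+-cong (≡⇒≈ (sym (substₚ-as-linExt p θ)))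
  (≈-trans (linExt-sumᴳ m _ p)
  (sum-cong m λ i → ≈-trans (linExt-++ᴳ _ _ p)
    (+-cong (≡⇒≈ (sym (substₚ-as-linExt p (θA i))))
      (≈-trans (linExt-negᴳ _ p) (neg-cong (≡⇒≈ (sym (substₚ-as-linExt p (θB i)))))))))))

SubstSum-subst : ∀ {r s t} m θ θA θB (α : Vec ℕ r) (τ : Fin s → Poly t) →
  substₚ (SubstSum m θ θA θB α) τ ≈
  SubstSum m (λ j → substₚ (θ j) τ) (λ i j → substₚ (θA i j) τ) (λ i j → substₚ (θB i j) τ) α
SubstSum-subst m θ θA θB α τ =
  ≈-trans (subst-++ (monoSubst α θ) (sumₚ m terms) τ) (+-cong (monoSubst-subst α θ τ)
  (≈-trans (subst-sum m terms τ) (sum-cong m λ i →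
    ≈-trans (subst-- (monoSubst α (θA i)) (monoSubst α (θB i)) τ)
            (+-cong (monoSubst-subst α (θA i) τ) (neg-cong (monoSubst-subst α (θB i) τ))))))
  where terms = λ i → monoSubst α (θA i) -ₚ monoSubst α (θB i)

SubstSum-mul : ∀ {r s} m (u : Poly s) a θ θA θB (α : Vec ℕ r) →
  (u ^ₚ a) *ₚ SubstSum m θ θA θB α ≈
  SubstSum m (u ∷σ θ) (λ i → u ∷σ θA i) (λ i → u ∷σ θB i) (a ∷ α)
SubstSum-mul m u a θ θA θB α = ≈-trans (*-distribˡ (u ^ₚ a) (monoSubst α θ) (sumₚ m terms))
  (+-cong ≈-refl (≈-trans (*-sum (u ^ₚ a) m terms) (sum-cong m λ i →
    ≈-trans (*-distribˡ (u ^ₚ a) (monoSubst α (θA i)) (-ₚ monoSubst α (θB i)))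
            (+-cong ≈-refl (*-negʳ (u ^ₚ a) (monoSubst α (θB i)))))))
  where terms = λ i → monoSubst α (θA i) -ₚ monoSubst α (θB i)

-- omitting i p = (x_{i+1} - x_i, x₁, …, x̂_p, …) (0-based indices): the gap
-- in the first slot, then the variables with x_p omitted.  The substitutions
-- A_i, B_i of the overview omit x_{i+1}, resp. x_i.
gap : ∀ {k} → Fin k → Poly (suc k)
gap i = var (suc i) -ₚ var (inject₁ i)

omitting : ∀ {k} → Fin k → Fin (suc k) → Fin (suc k) → Poly (suc k)
omitting i p = gap i ∷σ (λ j → var (punchIn p j))

omitNext : ∀ {k} → Fin k → Fin (suc k) → Poly (suc k)
omitNext i = omitting i (suc i)

omitThis : ∀ {k} → Fin k → Fin (suc k) → Poly (suc k)
omitThis i = omitting i (inject₁ i)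

-- (-1)^a (w^a M) = u^a M when w = -u: this turns the second term of ∘ into
-- x^α ∘ B_i.
signPow-cancel : ∀ {k} a (w u M : Poly k) → w ≈ -ₚ u → scaleₚ (signPow a) ((w ^ₚ a) *ₚ M) ≈ (u ^ₚ a) *ₚ M
signPow-cancel a w u M e =
  ≈-trans (scale-cong s (*-congˡ M (≈-trans (^-cong a e) (^-neg u a))))
  (≈-trans (scale-cong s (*-scaleˡ s (u ^ₚ a) M))
  (≈-trans (scale-scale s s _)
  (≈-trans (≡⇒≈ (cong (λ c → scaleₚ c ((u ^ₚ a) *ₚ M)) (signPow² a))) (scale-one _))))
  where s = signPow a

-ₚ-swap : ∀ {r} (x y : Poly r) → x -ₚ y ≈ -ₚ (y -ₚ x)
-ₚ-swap x y = ≈-ev _ _ λ h → begin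
  ev h (x -ₚ y)          ≡⟨ trans (ev-++ h x (-ₚ y)) (cong (ev h x +_) (ev-neg h y)) ⟩
  ev h x - ev h y        ≡⟨ solve 2 (λ a b → a :+ (:- b) := :- (b :+ (:- a))) refl (ev h x) (ev h y) ⟩
  - (ev h y - ev h x)    ≡⟨ sym (trans (ev-neg h (y -ₚ x)) (cong -_ (trans (ev-++ h y (-ₚ x)) (cong (ev h y +_) (ev-neg h x))))) ⟩
  ev h (-ₚ (y -ₚ x))     ∎
  where open ≡-Reasoning

circ-SubstSum : ∀ {k} a (β : Vec ℕ k) → circ a (mono β) ≈ SubstSum k var omitNext omitThis (a ∷ β)
circ-SubstSum {k} a β = +-cong (*-congʳ (var zero ^ₚ a) (subst-mono β (λ j → var (suc j))))
  (sum-cong k λ i → +-cong (*-congʳ (gap i ^ₚ a) (subst-mono β (λ j → var (punchIn (suc i) j))))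
    (neg-cong (≈-trans (scale-cong (signPow a) (*-congʳ (w i ^ₚ a) (subst-mono β (λ j → var (punchIn (inject₁ i) j)))))
      (signPow-cancel a (w i) (gap i) (monoSubst β (λ j → var (punchIn (inject₁ i) j)))
                      (-ₚ-swap (var (inject₁ i)) (var (suc i)))))))
  where
  w : Fin k → Poly (suc k)
  w i = var (inject₁ i) -ₚ var (suc i)

tailVars : ∀ {k} → Fin k → Poly (suc k)
tailVars j = var (suc j)

monoSubst-tailVars : ∀ {k} (β : Vec ℕ k) → monoSubst β tailVars ≈ mono (0 ∷ β)
monoSubst-tailVars β = ≈-trans (monoSubst-monos β (λ j → 0 ∷ unitVec j))
  (≡⇒≈ (cong mono (trans (combine-0∷ β unitVec) (cong (0 ∷_) (combine-unitVec β)))))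

prependExp : ∀ {k} → ℕ → Poly k → Poly (suc k)
prependExp a Q = L.map (λ { (c , β) → (c , a ∷ β) }) Q

ev-prependExp : ∀ {k} (h : Vec ℕ (suc k) → ℚ) a (Q : Poly k) →
  ev h (prependExp a Q) ≡ ev (λ β → h (a ∷ β)) Q
ev-prependExp h a [] = refl
ev-prependExp h a ((c , β) ∷ Q) = cong (c * h (a ∷ β) +_) (ev-prependExp h a Q)

indicator-∷ : ∀ {k} a b (α β : Vec ℕ k) → indicator (b ∷ β) (a ∷ α) ≡ indicator (b ∷ []) (a ∷ []) * indicator β α
indicator-∷ a b α β = byCases (a ℕ.≟ b) (≡-dec ℕ._≟_ α β)
  where
  ∷-injective : ∀ {k} {a b : ℕ} {α β : Vec ℕ k} → a ∷ α ≡ b ∷ β → (a ≡ b) × (α ≡ β)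
  ∷-injective refl = refl , refl
  byCases : Dec (a ≡ b) → Dec (α ≡ β) → indicator (b ∷ β) (a ∷ α) ≡ indicator (b ∷ []) (a ∷ []) * indicator β α
  byCases (yes refl) (yes refl) = trans (indicator-≡ (a ∷ α) (a ∷ α) refl)
    (sym (cong₂ _*_ (indicator-≡ (a ∷ []) (a ∷ []) refl) (indicator-≡ α α refl)))
  byCases (yes refl) (no ne) = trans (indicator-≢ (a ∷ α) (a ∷ β) (λ e → ne (proj₂ (∷-injective e))))
    (sym (trans (cong (indicator (a ∷ []) (a ∷ []) *_) (indicator-≢ α β ne)) (QP.*-zeroʳ (indicator (a ∷ []) (a ∷ [])))))
  byCases (no ne) _ = trans (indicator-≢ (a ∷ α) (b ∷ β) (λ e → ne (proj₁ (∷-injective e))))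
    (sym (trans (cong (_* indicator β α) (indicator-≢ (a ∷ []) (b ∷ []) (λ e → ne (proj₁ (∷-injective e)))))
                (QP.*-zeroˡ (indicator β α))))

coeff-prependExp : ∀ {k} a (Q : Poly k) b γ →
  coeff (prependExp a Q) (b ∷ γ) ≡ indicator (b ∷ []) (a ∷ []) * coeff Q γ
coeff-prependExp a Q b γ = begin
  coeff (prependExp a Q) (b ∷ γ)                        ≡⟨ coeff-ev (prependExp a Q) (b ∷ γ) ⟩
  ev (indicator (b ∷ γ)) (prependExp a Q)               ≡⟨ ev-prependExp (indicator (b ∷ γ)) a Q ⟩
  ev (λ β → indicator (b ∷ γ) (a ∷ β)) Q                ≡⟨ ev-congʰ Q (λ β → indicator-∷ a b β γ) ⟩
  ev (λ β → indicator (b ∷ []) (a ∷ []) * indicator γ β) Q ≡⟨ ev-*ʰ (indicator γ) (indicator (b ∷ []) (a ∷ [])) Q ⟩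
  indicator (b ∷ []) (a ∷ []) * ev (indicator γ) Q      ≡⟨ cong (indicator (b ∷ []) (a ∷ []) *_) (sym (coeff-ev Q γ)) ⟩
  indicator (b ∷ []) (a ∷ []) * coeff Q γ               ∎
  where open ≡-Reasoning

prependExp-as-product : ∀ {k} a (Q : Poly k) → prependExp a Q ≈ (var zero ^ₚ a) *ₚ substₚ Q tailVars
prependExp-as-product {k} a Q = ≈-ev _ _ λ h → sym (evs h)
  where
  open ≡-Reasoning
  x₁^a : Poly (suc k)
  x₁^a = var zero ^ₚ a
  aε : Vec ℕ (suc k)
  aε = a ∷ V.replicate k 0
  x₁^a≈ : x₁^a ≈ mono aε
  x₁^a≈ = ≈-trans (mono-^ (unitVec zero) a) (≡⇒≈ (cong mono (cong₂ _∷_ (NP.*-identityʳ a) (·v0 a))))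
  termwise : ∀ h β → ev (λ γ → h (aε ⊕ γ)) (monoSubst β tailVars) ≡ h (a ∷ β)
  termwise h β = trans (ev-cong _ (monoSubst-tailVars β))
    (trans (ev-mono (λ γ → h (aε ⊕ γ)) (0 ∷ β)) (cong h (cong₂ _∷_ (NP.+-identityʳ a) (⊕-identityˡ β))))
  evs : ∀ h → ev h (x₁^a *ₚ substₚ Q tailVars) ≡ ev h (prependExp a Q)
  evs h = begin
    ev h (x₁^a *ₚ Q′)                                 ≡⟨ ev-* h x₁^a Q′ ⟩
    ev (λ α → ev (λ β → h (α ⊕ β)) Q′) x₁^a           ≡⟨ ev-cong _ x₁^a≈ ⟩
    ev (λ α → ev (λ β → h (α ⊕ β)) Q′) (mono aε)      ≡⟨ ev-mono (λ α → ev (λ β → h (α ⊕ β)) Q′) aε ⟩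
    ev (λ β → h (aε ⊕ β)) Q′                          ≡⟨ ev-subst (λ β → h (aε ⊕ β)) Q tailVars ⟩
    ev (λ β → ev (λ γ → h (aε ⊕ γ)) (monoSubst β tailVars)) Q ≡⟨ ev-congʰ Q (termwise h) ⟩
    ev (λ β → h (a ∷ β)) Q                            ≡⟨ sym (ev-prependExp h a Q) ⟩
    ev h (prependExp a Q)                             ∎
    where
    Q′ : Poly (suc k)
    Q′ = substₚ Q tailVars

-- Row m of E is the coefficient vector of circMono (m - 1); row m of
-- E^{(r-1)} that of circMonoTail (m - 1), i.e. x₁^{m₁-1}(x^{m₂-1} ∘ x^{m''-1}).
circMono : ∀ {k} → Vec ℕ (suc k) → Poly (suc k)
circMono (a ∷ β) = circ a (mono β)

circMonoTail : ∀ {k} → Vec ℕ (suc (suc k)) → Poly (suc (suc k))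
circMonoTail (a ∷ α) = prependExp a (circMono α)

tailed : ∀ {n} → (Fin n → Poly n) → Fin (suc n) → Poly (suc n)
tailed τ = var zero ∷σ (λ j → substₚ (τ j) tailVars)

circMono-SubstSum : ∀ {k} (α : Vec ℕ (suc k)) → circMono α ≈ SubstSum k var omitNext omitThis α
circMono-SubstSum (a ∷ β) = circ-SubstSum a β

circMonoTail-SubstSum : ∀ {k} (α : Vec ℕ (suc (suc k))) →
  circMonoTail α ≈ SubstSum k (tailed var) (λ i → tailed (omitNext i)) (λ i → tailed (omitThis i)) α
circMonoTail-SubstSum {k} (a ∷ b ∷ β) = begin
  prependExp a (circ b (mono β))
    ≈⟨ prependExp-as-product a (circ b (mono β)) ⟩
  (var zero ^ₚ a) *ₚ substₚ (circ b (mono β)) tailVars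
    ≈⟨ *-congʳ (var zero ^ₚ a) (subst-cong tailVars (circ-SubstSum b β)) ⟩
  (var zero ^ₚ a) *ₚ substₚ (SubstSum k var omitNext omitThis (b ∷ β)) tailVars
    ≈⟨ *-congʳ (var zero ^ₚ a) (SubstSum-subst k var omitNext omitThis (b ∷ β) tailVars) ⟩
  (var zero ^ₚ a) *ₚ SubstSum k (λ j → substₚ (var j) tailVars) (λ i j → substₚ (omitNext i j) tailVars)
                                (λ i j → substₚ (omitThis i j) tailVars) (b ∷ β)
    ≈⟨ SubstSum-mul k (var zero) a (λ j → substₚ (var j) tailVars) (λ i j → substₚ (omitNext i j) tailVars)
                   (λ i j → substₚ (omitThis i j) tailVars) (b ∷ β) ⟩
  SubstSum k (tailed var) (λ i → tailed (omitNext i)) (λ i → tailed (omitThis i)) (a ∷ b ∷ β) ∎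
  where open SetoidReasoning (≈-setoid (suc (suc k)))

WRelation : ∀ {k} → Poly (suc (suc k)) → Set
WRelation P = P ≈ substₚ P σW₁ -ₚ substₚ P σW₂

negate-partner : ∀ {r} {p q : Poly r} → p ++ q ≈ [] → q ≈ -ₚ p
negate-partner {p = p} {q} e = mk≈ λ β → begin
  coeff q β                                    ≡⟨ solve 2 (λ a b → b := (a :+ b) :+ (:- a)) refl (coeff p β) (coeff q β) ⟩
  (coeff p β + coeff q β) + - coeff p β        ≡⟨ cong₂ _+_ (trans (sym (coeff-++ p q β)) (≈-at e β)) (sym (coeff-neg p β)) ⟩
  0ℚ + coeff (-ₚ p) β                          ≡⟨ QP.+-identityˡ _ ⟩
  coeff (-ₚ p) β                               ∎
  where open ≡-Reasoning

sub-sub : ∀ {r} (x y : Poly r) → x -ₚ (x -ₚ y) ≈ y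
sub-sub x y = mk≈ λ β → trans (coeff-- x (x -ₚ y) β) (trans (cong (λ z → coeff x β - z) (coeff-- x y β))
  (solve 2 (λ a b → a :- (a :- b) := b) refl (coeff x β) (coeff y β)))

add-sub : ∀ {r} (x y : Poly r) → (x ++ y) -ₚ x ≈ y
add-sub x y = mk≈ λ β → trans (coeff-- (x ++ y) x β) (trans (cong (_- coeff x β) (coeff-++ x y β))
  (solve 2 (λ a b → (a :+ b) :- a := b) refl (coeff x β) (coeff y β)))

otherVars : ∀ {k} → Fin k → Poly (suc (suc k))
otherVars j = var (suc (suc j))

swap₁₂ shear κ : ∀ {k} → Fin (suc (suc k)) → Poly (suc (suc k))
swap₁₂ = var (suc zero) ∷σ var zero ∷σ otherVars
shear  = var zero ∷σ (var zero ++ var (suc zero)) ∷σ otherVars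
κ      = var zero ∷σ (var (suc zero) -ₚ var zero) ∷σ otherVars

W-at-σW₁ : ∀ {k} (P : Poly (suc (suc k))) → WRelation P → substₚ P σW₁ ≈ P -ₚ substₚ P κ
W-at-σW₁ {k} P rel = begin
  substₚ P σW₁                                              ≈⟨ subst-cong σW₁ rel ⟩
  substₚ (substₚ P σW₁ -ₚ substₚ P σW₂) σW₁                 ≈⟨ subst-- (substₚ P σW₁) (substₚ P σW₂) σW₁ ⟩
  substₚ (substₚ P σW₁) σW₁ -ₚ substₚ (substₚ P σW₂) σW₁    ≈⟨ +-cong (subst-comp P σW₁ σW₁) (neg-cong (subst-comp P σW₂ σW₁)) ⟩
  substₚ P (λ i → substₚ (σW₁ i) σW₁) -ₚ substₚ P (λ i → substₚ (σW₂ i) σW₁)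
    ≈⟨ +-cong (≈-trans (subst-congσ P σW₁∘σW₁) (subst-id P)) (neg-cong (subst-congσ P σW₂∘σW₁)) ⟩
  P -ₚ substₚ P κ                                           ∎
  where
  open SetoidReasoning (≈-setoid (suc (suc k)))
  σW₁∘σW₁ : ∀ i → substₚ (σW₁ i) σW₁ ≈ var i
  σW₁∘σW₁ zero = ≈-trans (subst-var-- (suc zero) zero σW₁) (sub-sub (var (suc zero)) (var zero))
  σW₁∘σW₁ (suc zero) = subst-var (suc zero) σW₁
  σW₁∘σW₁ (suc (suc i)) = subst-var (suc (suc i)) σW₁
  σW₂∘σW₁ : ∀ i → substₚ (σW₂ i) σW₁ ≈ κ i
  σW₂∘σW₁ zero = ≈-trans (subst-var-- (suc zero) zero σW₁) (sub-sub (var (suc zero)) (var zero))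
  σW₂∘σW₁ (suc zero) = subst-var zero σW₁
  σW₂∘σW₁ (suc (suc i)) = subst-var (suc (suc i)) σW₁

W-κ : ∀ {k} (P : Poly (suc (suc k))) → WRelation P → substₚ P κ ++ substₚ P σW₂ ≈ []
W-κ P rel = mk≈ λ β → rearrange (≈-at rel β) (≈-at (W-at-σW₁ P rel) β)
  where
  rearrange : ∀ {β} → coeff P β ≡ coeff (substₚ P σW₁ -ₚ substₚ P σW₂) β →
    coeff (substₚ P σW₁) β ≡ coeff (P -ₚ substₚ P κ) β → coeff (substₚ P κ ++ substₚ P σW₂) β ≡ 0ℚ
  rearrange {β} e₁ e₂ rewrite coeff-++ (substₚ P κ) (substₚ P σW₂) β
    | coeff-- (substₚ P σW₁) (substₚ P σW₂) β | coeff-- P (substₚ P κ) β | e₂ = begin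
    c + w                      ≡⟨ solve 3 (λ p c w → c :+ w := p :- ((p :- c) :- w)) refl p c w ⟩
    p - ((p - c) - w)          ≡⟨ cong (λ z → p - z) (sym e₁) ⟩
    p - p                      ≡⟨ QP.+-inverseʳ p ⟩
    0ℚ                         ∎
    where
    open ≡-Reasoning
    p c w : ℚ
    p = coeff P β
    c = coeff (substₚ P κ) β
    w = coeff (substₚ P σW₂) β

-- Antisymmetry: the W-relation forces P(x₂, x₁, …) = -P(x₁, x₂, …).  Substituting
-- (x₁, x₁+x₂, …) into W-κ gives P + P∘swap₁₂ = 0, then substitute arbitrary values.
W-antisymmetric : ∀ {k} (P : Poly (suc (suc k))) → WRelation P →
  ∀ (u v : Poly (suc (suc k))) (ρ : Fin k → Poly (suc (suc k))) →
  substₚ P (u ∷σ v ∷σ ρ) ≈ -ₚ substₚ P (v ∷σ u ∷σ ρ)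
W-antisymmetric {k} P rel u v ρ = negate-partner (begin
  substₚ P θ ++ substₚ P (u ∷σ v ∷σ ρ)
    ≈⟨ +-cong ≈-refl (≈-sym (≈-trans (subst-comp P swap₁₂ θ) (subst-congσ P swap∘θ))) ⟩
  substₚ P θ ++ substₚ (substₚ P swap₁₂) θ       ≈⟨ ≈-sym (subst-++ P (substₚ P swap₁₂) θ) ⟩
  substₚ (P ++ substₚ P swap₁₂) θ                ≈⟨ subst-cong θ P+P∘swap ⟩
  substₚ [] θ                                    ∎)
  where
  open SetoidReasoning (≈-setoid (suc (suc k)))
  θ : Fin (suc (suc k)) → Poly (suc (suc k))
  θ = v ∷σ u ∷σ ρ
  swap∘θ : ∀ i → substₚ (swap₁₂ i) θ ≈ (u ∷σ v ∷σ ρ) i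
  swap∘θ zero = subst-var (suc zero) θ
  swap∘θ (suc zero) = subst-var zero θ
  swap∘θ (suc (suc i)) = subst-var (suc (suc i)) θ
  κ∘shear : ∀ i → substₚ (κ i) shear ≈ var i
  κ∘shear zero = subst-var zero shear
  κ∘shear (suc zero) = ≈-trans (subst-var-- (suc zero) zero shear) (add-sub (var zero) (var (suc zero)))
  κ∘shear (suc (suc i)) = subst-var (suc (suc i)) shear
  σW₂∘shear : ∀ i → substₚ (σW₂ i) shear ≈ swap₁₂ i
  σW₂∘shear zero = ≈-trans (subst-var-- (suc zero) zero shear) (add-sub (var zero) (var (suc zero)))
  σW₂∘shear (suc zero) = subst-var zero shear
  σW₂∘shear (suc (suc i)) = subst-var (suc (suc i)) shear
  P+P∘swap : P ++ substₚ P swap₁₂ ≈ []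
  P+P∘swap = begin
    P ++ substₚ P swap₁₂
      ≈⟨ ≈-sym (+-cong (≈-trans (subst-comp P κ shear) (≈-trans (subst-congσ P κ∘shear) (subst-id P)))
                       (≈-trans (subst-comp P σW₂ shear) (subst-congσ P σW₂∘shear))) ⟩
    substₚ (substₚ P κ) shear ++ substₚ (substₚ P σW₂) shear     ≈⟨ ≈-sym (subst-++ (substₚ P κ) (substₚ P σW₂) shear) ⟩
    substₚ (substₚ P κ ++ substₚ P σW₂) shear                     ≈⟨ subst-cong shear (W-κ P rel) ⟩
    substₚ [] shear                                              ∎

-- The tail substitution A'_i (resp. B'_i) is A_{i+1} (resp. B_{i+1}) with the
-- first two slots swapped, so by antisymmetry the two contributions cancel.
tailed-omitting : ∀ {k} (P : Poly (suc (suc (suc k)))) → WRelation P →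
  (i : Fin (suc k)) (p : Fin (suc (suc k))) →
  substₚ P (tailed (omitting i p)) ≈ -ₚ substₚ P (omitting (suc i) (suc p))
tailed-omitting {k} P rel i p = begin
  substₚ P (tailed (omitting i p))                  ≈⟨ subst-congσ P unfold ⟩
  substₚ P (var zero ∷σ gap′ ∷σ rest)               ≈⟨ W-antisymmetric P rel (var zero) gap′ rest ⟩
  -ₚ substₚ P (gap′ ∷σ var zero ∷σ rest)            ≈⟨ neg-cong (subst-congσ P swapped) ⟩
  -ₚ substₚ P (omitting (suc i) (suc p))            ∎
  where
  open SetoidReasoning (≈-setoid (suc (suc (suc k))))
  gap′ : Poly (suc (suc (suc k)))
  gap′ = substₚ (gap i) tailVars
  rest : Fin (suc k) → Poly (suc (suc (suc k)))
  rest j = substₚ (var (punchIn p j)) tailVars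
  unfold : ∀ j → tailed (omitting i p) j ≈ (var zero ∷σ gap′ ∷σ rest) j
  unfold zero = ≈-refl
  unfold (suc zero) = ≈-refl
  unfold (suc (suc j)) = ≈-refl
  swapped : ∀ j → (gap′ ∷σ var zero ∷σ rest) j ≈ omitting (suc i) (suc p) j
  swapped zero = subst-var-- (suc i) (inject₁ i) tailVars
  swapped (suc zero) = ≈-refl
  swapped (suc (suc j)) = subst-var (punchIn p j) tailVars

collect : ∀ {r} (p t s₁ s₂ : Poly r) → t ≈ -ₚ p → s₁ ++ s₂ ≈ [] → (p ++ (t ++ s₁)) ++ (p ++ s₂) ≈ p
collect p t s₁ s₂ t≈-p s≈0 = ≈-ev _ _ λ h → begin
  ev h ((p ++ (t ++ s₁)) ++ (p ++ s₂))
    ≡⟨ trans (ev-++ h (p ++ (t ++ s₁)) (p ++ s₂))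
             (cong₂ _+_ (trans (ev-++ h p (t ++ s₁)) (cong (ev h p +_) (ev-++ h t s₁))) (ev-++ h p s₂)) ⟩
  (ev h p + (ev h t + ev h s₁)) + (ev h p + ev h s₂)
    ≡⟨ solve 4 (λ p t a b → (p :+ (t :+ a)) :+ (p :+ b) := (p :+ t) :+ (p :+ (a :+ b)))
             refl (ev h p) (ev h t) (ev h s₁) (ev h s₂) ⟩
  (ev h p + ev h t) + (ev h p + (ev h s₁ + ev h s₂))
    ≡⟨ cong₂ (λ x y → (ev h p + x) + (ev h p + y))
             (trans (ev-cong h t≈-p) (ev-neg h p)) (trans (sym (ev-++ h s₁ s₂)) (ev-cong h s≈0)) ⟩
  (ev h p + - ev h p) + (ev h p + 0ℚ)
    ≡⟨ solve 1 (λ p → (p :+ (:- p)) :+ (p :+ con 0ℚ) := p) refl (ev h p) ⟩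
  ev h p ∎
  where open ≡-Reasoning

difference-cancel : ∀ {r} (a b : Poly r) → (a -ₚ b) ++ ((-ₚ a) -ₚ (-ₚ b)) ≈ []
difference-cancel a b = mk≈ λ β → begin
  coeff ((a -ₚ b) ++ ((-ₚ a) -ₚ (-ₚ b))) β
    ≡⟨ trans (coeff-++ (a -ₚ b) ((-ₚ a) -ₚ (-ₚ b)) β) (cong₂ _+_ (coeff-- a b β) (coeff-- (-ₚ a) (-ₚ b) β)) ⟩
  (coeff a β - coeff b β) + (coeff (-ₚ a) β - coeff (-ₚ b) β)
    ≡⟨ cong₂ (λ x y → (coeff a β - coeff b β) + (x - y)) (coeff-neg a β) (coeff-neg b β) ⟩
  (coeff a β - coeff b β) + (- coeff a β - - coeff b β)
    ≡⟨ solve 2 (λ x y → (x :- y) :+ ((:- x) :- (:- y)) := con 0ℚ) refl (coeff a β) (coeff b β) ⟩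
  0ℚ ∎
  where open ≡-Reasoning

circ-identity : ∀ {k} (P : Poly (suc (suc (suc k)))) → WRelation P →
  linExt circMono P ++ linExt circMonoTail P ≈ P
circ-identity {k} P rel = begin
  linExt circMono P ++ linExt circMonoTail P
    ≈⟨ +-cong (linExt-SubstSum (suc (suc k)) var omitNext omitThis circMono circMono-SubstSum P)
              (linExt-SubstSum (suc k) (tailed var) (λ i → tailed (omitNext i)) (λ i → tailed (omitThis i))
                               circMonoTail circMonoTail-SubstSum P) ⟩
  (substₚ P var ++ (term zero ++ S₁)) ++ (substₚ P (tailed var) ++ S₂)
    ≈⟨ +-cong (+-cong (subst-id P) ≈-refl) (+-cong P∘tailed-var ≈-refl) ⟩
  (P ++ (term zero ++ S₁)) ++ (P ++ S₂)
    ≈⟨ collect P (term zero) S₁ S₂ first-term S₁+S₂ ⟩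
  P ∎
  where
  open SetoidReasoning (≈-setoid (suc (suc (suc k))))
  term : Fin (suc (suc k)) → Poly (suc (suc (suc k)))
  term i = substₚ P (omitNext i) -ₚ substₚ P (omitThis i)
  termTail : Fin (suc k) → Poly (suc (suc (suc k)))
  termTail i = substₚ P (tailed (omitNext i)) -ₚ substₚ P (tailed (omitThis i))
  S₁ S₂ : Poly (suc (suc (suc k)))
  S₁ = sumₚ (suc k) (λ i → term (suc i))
  S₂ = sumₚ (suc k) termTail
  -- A₀ = σW₂ and B₀ = σW₁, so the first term is -P by the W-relation.
  first-term : term zero ≈ -ₚ P
  first-term = ≈-trans (+-cong (subst-congσ P A₀) (neg-cong (subst-congσ P B₀)))
    (≈-trans (-ₚ-swap (substₚ P σW₂) (substₚ P σW₁)) (neg-cong (≈-sym rel)))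
    where
    A₀ : ∀ j → omitNext zero j ≈ σW₂ j
    A₀ zero = ≈-refl
    A₀ (suc zero) = ≈-refl
    A₀ (suc (suc j)) = ≈-refl
    B₀ : ∀ j → omitThis zero j ≈ σW₁ j
    B₀ zero = ≈-refl
    B₀ (suc zero) = ≈-refl
    B₀ (suc (suc j)) = ≈-refl
  pairs-cancel : ∀ i → term (suc i) ++ termTail i ≈ []
  pairs-cancel i = ≈-trans
    (+-cong {p = term (suc i)} ≈-refl (+-cong (tailed-omitting P rel i (suc i)) (neg-cong (tailed-omitting P rel i (inject₁ i)))))
    (difference-cancel (substₚ P (omitNext (suc i))) (substₚ P (omitThis (suc i))))
  S₁+S₂ : S₁ ++ S₂ ≈ []
  S₁+S₂ = ≈-trans (sum-++ (suc k) (λ i → term (suc i)) termTail)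
          (sum-zero (suc k) (λ i → term (suc i) ++ termTail i) pairs-cancel)
  tailed-var : ∀ j → tailed var j ≈ var j
  tailed-var zero = ≈-refl
  tailed-var (suc j) = subst-var j tailVars
  P∘tailed-var : substₚ P (tailed var) ≈ P
  P∘tailed-var = ≈-trans (subst-congσ P tailed-var) (subst-id P)

sumList : ∀ {A : Set} → List A → (A → ℚ) → ℚ
sumList xs g = L.foldr _+_ 0ℚ (L.map g xs)

sumList-++ : ∀ {A : Set} (xs ys : List A) g → sumList (xs ++ ys) g ≡ sumList xs g + sumList ys g
sumList-++ [] ys g = sym (QP.+-identityˡ _)
sumList-++ (x ∷ xs) ys g =
  trans (cong (g x +_) (sumList-++ xs ys g)) (sym (QP.+-assoc (g x) (sumList xs g) (sumList ys g)))

sumList-cong : ∀ {A : Set} (xs : List A) {g g' : A → ℚ} → (∀ x → g x ≡ g' x) → sumList xs g ≡ sumList xs g'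
sumList-cong [] e = refl
sumList-cong (x ∷ xs) e = cong₂ _+_ (e x) (sumList-cong xs e)

sumList-* : ∀ {A : Set} (xs : List A) c g → sumList xs (λ x → c * g x) ≡ c * sumList xs g
sumList-* [] c g = sym (QP.*-zeroʳ c)
sumList-* (x ∷ xs) c g =
  trans (cong (c * g x +_) (sumList-* xs c g)) (sym (QP.*-distribˡ-+ c (g x) (sumList xs g)))

sumList-map : ∀ {A B : Set} (f : A → B) (xs : List A) g → sumList (L.map f xs) g ≡ sumList xs (λ x → g (f x))
sumList-map f [] g = refl
sumList-map f (x ∷ xs) g = cong (g (f x) +_) (sumList-map f xs g)

sumList-cong-S : ∀ N {r} (xs : List (Vec ℕ r)) {g g' : Vec ℕ r → ℚ} → (∀ m → InS N m → g m ≡ g' m) →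
  sumList (L.filter (inS? N) xs) g ≡ sumList (L.filter (inS? N) xs) g'
sumList-cong-S N [] e = refl
sumList-cong-S N (x ∷ xs) {g} {g'} e with inS? N x
... | yes x∈S = trans (cong (λ ys → sumList ys g) (LP.filter-accept (inS? N) x∈S))
   (trans (cong₂ _+_ (e x x∈S) (sumList-cong-S N xs e)) (sym (cong (λ ys → sumList ys g') (LP.filter-accept (inS? N) x∈S))))
... | no x∉S = trans (cong (λ ys → sumList ys g) (LP.filter-reject (inS? N) x∉S))
   (trans (sumList-cong-S N xs e) (sym (cong (λ ys → sumList ys g') (LP.filter-reject (inS? N) x∉S))))

multiplicity : ∀ {r} → Vec ℕ r → List (Vec ℕ r) → ℚ
multiplicity v xs = sumList xs (indicator v)

multiplicity-filter : ∀ {r} N (v : Vec ℕ r) xs → InS N v →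
  multiplicity v (L.filter (inS? N) xs) ≡ multiplicity v xs
multiplicity-filter N v [] v∈S = refl
multiplicity-filter N v (x ∷ xs) v∈S with inS? N x
... | yes x∈S = trans (cong (multiplicity v) (LP.filter-accept (inS? N) x∈S))
  (cong (indicator v x +_) (multiplicity-filter N v xs v∈S))
... | no x∉S = trans (cong (multiplicity v) (LP.filter-reject (inS? N) x∉S))
  (trans (multiplicity-filter N v xs v∈S)
    (sym (trans (cong (_+ multiplicity v xs) (indicator-≢ x v (λ e → x∉S (subst (InS N) (sym e) v∈S))))
                (QP.+-identityˡ _))))

indicator₁ : ℕ → ℕ → ℚ
indicator₁ x k = indicator (x ∷ []) (k ∷ [])

indicator₁-≢ : ∀ {x k} → ¬ (k ≡ x) → indicator₁ x k ≡ 0ℚ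
indicator₁-≢ {x} {k} ne = indicator-≢ (k ∷ []) (x ∷ []) (λ { refl → ne refl })

sumList-upTo-suc : ∀ n g → sumList (L.upTo (suc n)) g ≡ sumList (L.upTo n) g + (g n + 0ℚ)
sumList-upTo-suc n g = trans (cong (λ xs → sumList xs g) (sym (LP.upTo-∷ʳ n))) (sumList-++ (L.upTo n) (n ∷ []) g)

count-upTo-≥ : ∀ n x → n ≤ x → sumList (L.upTo n) (indicator₁ x) ≡ 0ℚ
count-upTo-≥ zero x le = refl
count-upTo-≥ (suc n) x le = trans (sumList-upTo-suc n (indicator₁ x))
  (cong₂ (λ a b → a + (b + 0ℚ)) (count-upTo-≥ n x (NP.≤-trans (NP.n≤1+n n) le)) (indicator₁-≢ (NP.<⇒≢ le)))

count-upTo-< : ∀ n x → x < n → sumList (L.upTo n) (indicator₁ x) ≡ 1ℚ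
count-upTo-< (suc n) x (s≤s le) with x ℕ.≟ n
... | yes refl = trans (sumList-upTo-suc x (indicator₁ x))
  (cong₂ (λ a b → a + (b + 0ℚ)) (count-upTo-≥ x x NP.≤-refl) (indicator-≡ (x ∷ []) (x ∷ []) refl))
... | no ne = trans (sumList-upTo-suc n (indicator₁ x))
  (trans (cong₂ (λ a b → a + (b + 0ℚ)) (count-upTo-< n x (NP.≤∧≢⇒< le ne)) (indicator₁-≢ (λ e → ne (sym e)))) refl)

multiplicity-prefix : ∀ {r} x (v : Vec ℕ r) (vs : List (Vec ℕ r)) (ks : List ℕ) →
  multiplicity (x ∷ v) (L.concatMap (λ k → L.map (k ∷_) vs) ks) ≡ sumList ks (λ k → indicator₁ x k * multiplicity v vs)
multiplicity-prefix x v vs [] = refl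
multiplicity-prefix x v vs (k ∷ ks) = trans (sumList-++ (L.map (k ∷_) vs) _ (indicator (x ∷ v)))
  (cong₂ _+_ (trans (sumList-map (k ∷_) vs (indicator (x ∷ v)))
                    (trans (sumList-cong vs (λ w → indicator-∷ k x w v)) (sumList-* vs (indicator₁ x k) (indicator v))))
             (multiplicity-prefix x v vs ks))

multiplicity-vecsUpTo : ∀ B r (v : Vec ℕ r) → VAll.All (_≤ B) v → multiplicity v (vecsUpTo B r) ≡ 1ℚ
multiplicity-vecsUpTo B zero [] [] = refl
multiplicity-vecsUpTo B (suc r) (x ∷ v) (x≤B ∷ v≤B) = begin
  multiplicity (x ∷ v) (vecsUpTo B (suc r))
    ≡⟨ multiplicity-prefix x v (vecsUpTo B r) (L.upTo (suc B)) ⟩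
  sumList (L.upTo (suc B)) (λ k → indicator₁ x k * multiplicity v (vecsUpTo B r))
    ≡⟨ sumList-cong (L.upTo (suc B)) (λ k → trans (cong (indicator₁ x k *_) (multiplicity-vecsUpTo B r v v≤B))
                                                  (QP.*-identityʳ (indicator₁ x k))) ⟩
  sumList (L.upTo (suc B)) (indicator₁ x)
    ≡⟨ count-upTo-< (suc B) x (s≤s x≤B) ⟩
  1ℚ ∎
  where open ≡-Reasoning

-- Entries of an index in S_{N,r} are at most N, so it occurs in vecsUpTo N r.
entries-≤-sum : ∀ {r} (v : Vec ℕ r) → VAll.All (_≤ V.sum v) v
entries-≤-sum [] = []
entries-≤-sum (x ∷ v) = NP.m≤m+n x (V.sum v)
  ∷ VAll.map (λ le → NP.≤-trans le (NP.m≤n+m (V.sum v) x)) (entries-≤-sum v)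

multiplicity-Slist : ∀ N {r} (v : Vec ℕ r) → InS N v → multiplicity v (Slist N r) ≡ 1ℚ
multiplicity-Slist N {r} v v∈S = trans (multiplicity-filter N v (vecsUpTo N r) v∈S)
  (multiplicity-vecsUpTo N r v (subst (λ z → VAll.All (_≤ z) v) (proj₁ v∈S) (entries-≤-sum v)))

Positive : ∀ {r} → Vec ℕ r → Set
Positive m = VAll.All (1 ≤_) m

minus1-suc : ∀ {r} (β : Vec ℕ r) → minus1 (V.map suc β) ≡ β
minus1-suc [] = refl
minus1-suc (x ∷ β) = cong (x ∷_) (minus1-suc β)

suc-minus1 : ∀ {r} (m : Vec ℕ r) → Positive m → V.map suc (minus1 m) ≡ m
suc-minus1 [] [] = refl
suc-minus1 (suc x ∷ m) (s≤s _ ∷ p) = cong (suc x ∷_) (suc-minus1 m p)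

InS⇒Positive : ∀ {r} N (m : Vec ℕ r) → InS N m → Positive m
InS⇒Positive N m (_ , entries) = VAll.map (λ { (3≤k , _) → NP.≤-trans (s≤s z≤n) 3≤k }) entries

onS : ∀ {r} → ℕ → Poly r → Poly r
onS {r} N P = L.map (λ m → (coeff P (minus1 m) , minus1 m)) (Slist N r)

ev-onS : ∀ {r} N (P : Poly r) h → ev h (onS N P) ≡ sumS N r (λ m → coeff P (minus1 m) * h (minus1 m))
ev-onS {r} N P h = go (Slist N r)
  where
  go : ∀ ms → ev h (L.map (λ m → (coeff P (minus1 m) , minus1 m)) ms)
            ≡ sumList ms (λ m → coeff P (minus1 m) * h (minus1 m))
  go [] = refl
  go (m ∷ ms) = cong (coeff P (minus1 m) * h (minus1 m) +_) (go ms)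

onS-≈ : ∀ N {r} (P : Poly r) → InV N P → onS N P ≈ P
onS-≈ N {r} P P∈V = mk≈ λ β → begin
  coeff (onS N P) β
    ≡⟨ trans (coeff-ev (onS N P) β) (ev-onS N P (indicator β)) ⟩
  sumS N r (λ m → coeff P (minus1 m) * indicator β (minus1 m))
    ≡⟨ sumList-cong-S N (vecsUpTo N r) (λ m m∈S → termwise m β (InS⇒Positive N m m∈S) (≡-dec ℕ._≟_ (minus1 m) β)) ⟩
  sumS N r (λ m → coeff P β * indicator (V.map suc β) m)
    ≡⟨ sumList-* (Slist N r) (coeff P β) (indicator (V.map suc β)) ⟩
  coeff P β * multiplicity (V.map suc β) (Slist N r)
    ≡⟨ support β (coeff P β QP.≟ 0ℚ) ⟩
  coeff P β ∎
  where
  open ≡-Reasoning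
  termwise : ∀ m β → Positive m → Dec (minus1 m ≡ β) →
    coeff P (minus1 m) * indicator β (minus1 m) ≡ coeff P β * indicator (V.map suc β) m
  termwise m β pm (yes refl) = cong (coeff P (minus1 m) *_)
    (trans (indicator-≡ (minus1 m) (minus1 m) refl) (sym (indicator-≡ m (V.map suc (minus1 m)) (sym (suc-minus1 m pm)))))
  termwise m β pm (no ne) = trans (cong (coeff P (minus1 m) *_) (indicator-≢ (minus1 m) β ne))
    (trans (QP.*-zeroʳ (coeff P (minus1 m)))
      (sym (trans (cong (coeff P β *_) (indicator-≢ m (V.map suc β) (λ e → ne (trans (cong minus1 e) (minus1-suc β)))))
                  (QP.*-zeroʳ (coeff P β)))))
  -- a nonzero coefficient sits at an exponent m - 1 with m ∈ S_{N,r}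
  support : ∀ β → Dec (coeff P β ≡ 0ℚ) → coeff P β * multiplicity (V.map suc β) (Slist N r) ≡ coeff P β
  support β (yes z) = trans (cong (_* multiplicity (V.map suc β) (Slist N r)) z)
    (trans (QP.*-zeroˡ (multiplicity (V.map suc β) (Slist N r))) (sym z))
  support β (no nz) = trans (cong (coeff P β *_) (multiplicity-Slist N (V.map suc β) (P∈V β nz))) (QP.*-identityʳ _)

sumS-π : ∀ N {r} (P : Poly r) → InV N P → ∀ (f : Vec ℕ r → ℚ) →
  sumS N r (λ m → π P m * f m) ≡ ev (λ α → f (V.map suc α)) P
sumS-π N {r} P P∈V f = sym (begin
  ev (λ α → f (V.map suc α)) P
    ≡⟨ ev-cong _ (≈-sym (onS-≈ N P P∈V)) ⟩
  ev (λ α → f (V.map suc α)) (onS N P)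
    ≡⟨ ev-onS N P (λ α → f (V.map suc α)) ⟩
  sumS N r (λ m → coeff P (minus1 m) * f (V.map suc (minus1 m)))
    ≡⟨ sumList-cong-S N (vecsUpTo N r)
         (λ m m∈S → cong (λ z → coeff P (minus1 m) * f z) (suc-minus1 m (InS⇒Positive N m m∈S))) ⟩
  sumS N r (λ m → π P m * f m) ∎)
  where open ≡-Reasoning

δ-entry : ∀ {r} (α : Vec ℕ r) n → Positive n → δ (V.map suc α) n ≡ indicator (minus1 n) α
δ-entry α n pn with ≡-dec ℕ._≟_ (V.map suc α) n
... | yes e = sym (indicator-≡ α (minus1 n) (trans (sym (minus1-suc α)) (cong minus1 e)))
... | no ne = sym (indicator-≢ α (minus1 n) (λ e → ne (trans (cong (V.map suc) e) (suc-minus1 n pn))))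

E-entry : ∀ {k} (α n : Vec ℕ (suc k)) → e (V.map suc α) n ≡ coeff (circMono α) (minus1 n)
E-entry (a ∷ β) n = cong (λ z → coeff (circ a (mono z)) (minus1 n)) (minus1-suc β)

Eʲ-entry : ∀ {k} (α n : Vec ℕ (suc (suc k))) → Positive n →
  Eʲ 1 (V.map suc α) n ≡ coeff (circMonoTail α) (minus1 n)
Eʲ-entry (a ∷ α) (n₁ ∷ n) (p₁ ∷ _) = begin
  δ (suc a ∷ []) (n₁ ∷ []) * e (V.map suc α) n
    ≡⟨ cong₂ _*_ (δ-entry (a ∷ []) (n₁ ∷ []) (p₁ ∷ [])) (E-entry α n) ⟩
  indicator (pred n₁ ∷ []) (a ∷ []) * coeff (circMono α) (minus1 n)
    ≡⟨ sym (coeff-prependExp a (circMono α) (pred n₁) (minus1 n)) ⟩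
  coeff (prependExp a (circMono α)) (pred n₁ ∷ minus1 n) ∎
  where open ≡-Reasoning

rowMul-F : ∀ N {k} (P : Poly (suc k)) → InV N P → (n : Vec ℕ (suc k)) → Positive n →
  rowMul N (suc k) (π P) F n ≡ coeff (linExt circMono P) (minus1 n) - coeff P (minus1 n)
rowMul-F N P P∈V n pn = begin
  sumS N _ (λ m → π P m * F m n)
    ≡⟨ sumS-π N P P∈V (λ m → F m n) ⟩
  ev (λ α → e (V.map suc α) n - δ (V.map suc α) n) P
    ≡⟨ ev-+ʰ (λ α → e (V.map suc α) n) (λ α → - δ (V.map suc α) n) P ⟩
  ev (λ α → e (V.map suc α) n) P + ev (λ α → - δ (V.map suc α) n) P
    ≡⟨ cong₂ _+_ (ev-congʰ P (λ α → E-entry α n)) (ev-negʰ (λ α → δ (V.map suc α) n) P) ⟩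
  ev (λ α → coeff (circMono α) (minus1 n)) P + - ev (λ α → δ (V.map suc α) n) P
    ≡⟨ cong₂ (λ x y → x + - y) (sym (coeff-linExt circMono P (minus1 n)))
             (trans (ev-congʰ P (λ α → δ-entry α n pn)) (sym (coeff-ev P (minus1 n)))) ⟩
  coeff (linExt circMono P) (minus1 n) - coeff P (minus1 n) ∎
  where open ≡-Reasoning

rowMul-Eʲ : ∀ N {k} (P : Poly (suc (suc k))) → InV N P → (n : Vec ℕ (suc (suc k))) → Positive n →
  rowMul N (suc (suc k)) (π (-ₚ P)) (Eʲ 1) n ≡ - coeff (linExt circMonoTail P) (minus1 n)
rowMul-Eʲ N P P∈V n pn = begin
  sumS N _ (λ m → π (-ₚ P) m * Eʲ 1 m n)
    ≡⟨ sumList-cong (Slist N _) (λ m → trans (cong (_* Eʲ 1 m n) (coeff-neg P (minus1 m)))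
         (trans (sym (QP.neg-distribˡ-* (π P m) (Eʲ 1 m n))) (QP.neg-distribʳ-* (π P m) (Eʲ 1 m n)))) ⟩
  sumS N _ (λ m → π P m * - Eʲ 1 m n)
    ≡⟨ sumS-π N P P∈V (λ m → - Eʲ 1 m n) ⟩
  ev (λ α → - Eʲ 1 (V.map suc α) n) P
    ≡⟨ ev-negʰ (λ α → Eʲ 1 (V.map suc α) n) P ⟩
  - ev (λ α → Eʲ 1 (V.map suc α) n) P
    ≡⟨ cong -_ (trans (ev-congʰ P (λ α → Eʲ-entry α n pn)) (sym (coeff-linExt circMonoTail P (minus1 n)))) ⟩
  - coeff (linExt circMonoTail P) (minus1 n) ∎
  where open ≡-Reasoning

lemma4p10 : (N k : ℕ) → 1 ≤ N → (P : Poly (3 ℕ.+ k)) → InW N P →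
    (n : Vec ℕ (3 ℕ.+ k)) → InS N n →
      rowMul N (3 ℕ.+ k) (π (-ₚ P)) (Eʲ 1) n ≡ rowMul N (3 ℕ.+ k) (π P) F n
lemma4p10 N k _ P (P∈V , rel) n n∈S = begin
  rowMul N (3 ℕ.+ k) (π (-ₚ P)) (Eʲ 1) n   ≡⟨ rowMul-Eʲ N P P∈V n pn ⟩
  - c′                                     ≡⟨ solve 2 (λ c c′ → :- c′ := c :- (c :+ c′)) refl c c′ ⟩
  c - (c + c′)                             ≡⟨ cong (λ z → c - z) identity ⟩
  c - coeff P (minus1 n)                   ≡⟨ sym (rowMul-F N P P∈V n pn) ⟩
  rowMul N (3 ℕ.+ k) (π P) F n             ∎
  where
  open ≡-Reasoning
  pn : Positive n
  pn = InS⇒Positive N n n∈S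
  c c′ : ℚ
  c = coeff (linExt circMono P) (minus1 n)
  c′ = coeff (linExt circMonoTail P) (minus1 n)
  identity : c + c′ ≡ coeff P (minus1 n)
  identity = trans (sym (coeff-++ (linExt circMono P) (linExt circMonoTail P) (minus1 n)))
                   (≈-at (circ-identity P (mk≈ rel)) (minus1 n))
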